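{- Let $n\in\mathbb{N}$, $A\subseteq[n]^2$, let $\Gamma=\Gamma(A)$ be the gate described in the context, and let $x\in\{0,1\}^{4n}$ satisfy $\varphi_{one}(x)$. (1) If $x_W\neq x_E$ or $\mathrm{hw}(x_S)\neq1$, then $\mathrm{Sig}(\Gamma,x)=0$. (2) If $\varphi_{prop}(x)$ holds, let $u:=x_W$ and $v:=x_N$ (as indices in $[n]$). Then $\mathrm{Sig}(\Gamma,x)=q_u-r_{u,v}-s_{u,v}-\alpha_{u,v}-\beta_{u,v}$ if $(u,v)\notin A$, and $\mathrm{Sig}(\Gamma,x)=q_u-r_{u,v}-s_{u,v}+1$ if $(u,v)\in A$. (3) If $x_W=x_E$, $\mathrm{hw}(x_S)=1$ and $x_N\neq x_S$, let $u:=x_W$, $v:=x_N$, $w:=x_S$. Then $\mathrm{Sig}(\Gamma,x)$ equals $p_{u,v,w}$ if $(u,v)\notin A,(u,w)\notin A$; $p_{u,v,w}+\alpha_{u,v}-\beta_{u,v}$ if $(u,v)\notin A,(u,w)\in A$; $p_{u,v,w}+\beta_{u,w}-\alpha_{u,w}$ if $(u,v)\in A,(u,w)\notin A$; and $p_{u,v,w}+\beta_{u,w}-\alpha_{u,w}+\alpha_{u,v}-\beta_{u,v}+1$ if $(u,v)\in A,(u,w)\in A$.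
   Context: Notation: $\mathrm{hw}(z)$ = number of ones of $z$; $\mathrm{HW}_{=1}(z)=[\mathrm{hw}(z)=1]$. Signatures on $\{0,1\}^4$ (bits ordered north, east, south, west): $\mathrm{PASS}(y)=-1$ if $y=1111$; $=1$ if $y\in\{0000,0101,1010\}$; $=0$ otherwise. On $\{0,1\}^6$, writing $x=yab$ with $y\in\{0,1\}^4$: $\mathrm{PRE}(x)=\mathrm{PASS}(y)$ if $ab=00$; $=1$ if $x\in\{101011,111111,100001,110101,001010,011110\}$; $=0$ otherwise. A gate is an edge-weighted multigraph with vertex functions $f_v:\{0,1\}^{I(v)}\to\mathbb{C}$ ($I(v)$ = incident edges in a specified order) and a set $D$ of dangling edges (one endpoint, weight $1$); $\mathrm{Sig}(\Gamma,x)=\sum_{y\in\{0,1\}^{E\setminus D}}\prod_{e:(xy)(e)=1}w(e)\prod_v f_v((xy)|_{I(v)})$ for $x\in\{0,1\}^D$. $\Gamma(A)$: vertices $b_{i,j}$, $i,j\in[n]$ ($i$ row from top, $j$ column); for $i<n$ an edge joins $b_{i,j}$ (its south edge) and $b_{i+1,j}$ (its north edge); for $j<n$ an edge joins $b_{i,j}$ (east) and $b_{i,j+1}$ (west); dangling edges: north of $b_{1,j}$, south of $b_{n,j}$, west of $b_{i,1}$, east of $b_{i,n}$; first four edges of each $b_{i,j}$ ordered north, east, south, west. Two apex vertices $a_1,a_2$ with function $\mathrm{HW}_{=1}$. For $\tau\in A$, $b_\tau$ has function $\mathrm{PRE}$ with 5th edge $a_1b_\tau$ and 6th edge $a_2b_\tau$;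 every other $b_\tau$ has $\mathrm{PASS}$. All edge weights $1$. An assignment to dangling edges is $x=x_Nx_Ex_Sx_W\in\{0,1\}^{4n}$ with $x_N(j)$ the north dangling edge of $b_{1,j}$, $x_S(j)$ the south one of $b_{n,j}$, $x_W(i)$ the west one of $b_{i,1}$, $x_E(i)$ the east one of $b_{i,n}$; strings $0^{v-1}10^{n-v}$ are identified with $v\in[n]$. $\varphi_{one}(x)$: $\mathrm{hw}(x_N)=\mathrm{hw}(x_W)=1$; $\varphi_{prop}(x)$: $x_N=x_S$ and $x_W=x_E$. For $u,v,w\in[n]$: $\alpha_{u,v}=|\{i<u:(i,v)\in A\}|$, $\beta_{u,v}=|\{i>u:(i,v)\in A\}|$, $q_u=\sum_{z\in[n]}\big(\alpha_{u,z}\beta_{u,z}-\binom{\alpha_{u,z}}{2}-\binom{\beta_{u,z}}{2}\big)$, $p_{u,v,w}=(\alpha_{u,v}-\beta_{u,v})(\beta_{u,w}-\alpha_{u,w})$, $r_{u,v}=\sum_{z\in[n]\setminus\{v\},(u,z)\in A}\beta_{u,z}$, $s_{u,v}=\sum_{z\in[n]\setminus\{v\},(u,z)\in A}\alpha_{u,z}$. -}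

module Defs where

open import Data.Bool using (Bool; true; false; if_then_else_; _∧_; not)
open import Data.Nat as ℕ using (ℕ; zero; suc; _≡ᵇ_; _<ᵇ_)
open import Data.Nat.Combinatorics using (_C_)
open import Data.Integer as ℤ using (ℤ; +_; -_; _+_; _-_; _*_; 0ℤ; 1ℤ)
open import Data.Fin as Fin using (Fin; toℕ; inject₁)
import Data.Fin.Properties as FinP
open import Data.List using (List; []; _∷_; map; foldr; allFin; cartesianProduct; filterᵇ; length; _++_)
open import Data.Product using (_×_; _,_)
open import Data.Product.Properties using (≡-dec)
open import Data.Sum using (_⊎_; inj₁; inj₂; [_,_])
open import Relation.Binary.PropositionalEquality using (_≡_; refl)
open import Relation.Binary.Definitions using (DecidableEquality)
open import Relation.Nullary using (yes; no; does)

hw : List Bool → ℕ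
hw [] = 0
hw (true ∷ bs) = suc (hw bs)
hw (false ∷ bs) = hw bs

prodℤ : List ℤ → ℤ
prodℤ = foldr _*_ 1ℤ

sumℤ : List ℤ → ℤ
sumℤ = foldr _+_ 0ℤ

-- Vertices are enumerated by 'vtxs'; internal (non-dangling)
-- edges are enumerated (without repetition) by 'internal'; dangling
-- edges form the type 'Dang'.  The incident edges of a vertex v are the
-- list 'inc v' (in the specified order), and 'f v' is its function on
-- {0,1}^{I(v)} (lists of the same length as 'inc v').  Dangling edges have
-- weight 1, so only internal edge weights 'w' are recorded.
record Gate : Set₁ where
  field
    Vtx      : Set
    vtxs     : List Vtx
    Edge     : Set
    _≟E_     : DecidableEquality Edge
    internal : List Edge
    Dang     : Set
    inc      : Vtx → List (Dang ⊎ Edge)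
    f        : Vtx → List Bool → ℤ
    w        : Edge → ℤ

-- Sum of F over all assignments y : (edges in es) → {0,1}
-- (edges outside es are set to 0, they are never inspected).
module _ {E : Set} (_≟_ : DecidableEquality E) where
  update : (E → Bool) → E → Bool → (E → Bool)
  update g e b e' = if does (e' ≟ e) then b else g e'

  sumAssign : List E → ((E → Bool) → ℤ) → ℤ
  sumAssign [] F = F (λ _ → false)
  sumAssign (e ∷ es) F =
    sumAssign es (λ g → F (update g e false)) + sumAssign es (λ g → F (update g e true))

Sig : (Γ : Gate) → (Gate.Dang Γ → Bool) → ℤ
Sig Γ x = sumAssign _≟E_ internal λ y →
    prodℤ (map (λ e → if y e then w e else 1ℤ) internal)
  * prodℤ (map (λ v → f v (map [ x , y ] (inc v))) vtxs)
  where open Gate Γ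

HW₌₁ : List Bool → ℤ
HW₌₁ z = if hw z ≡ᵇ 1 then 1ℤ else 0ℤ

-- bits ordered north, east, south, west
PASS : List Bool → ℤ
PASS (true ∷ true ∷ true ∷ true ∷ []) = - 1ℤ
PASS (false ∷ false ∷ false ∷ false ∷ []) = 1ℤ
PASS (false ∷ true ∷ false ∷ true ∷ []) = 1ℤ
PASS (true ∷ false ∷ true ∷ false ∷ []) = 1ℤ
PASS _ = 0ℤ

PRE : List Bool → ℤ
PRE (y₁ ∷ y₂ ∷ y₃ ∷ y₄ ∷ false ∷ false ∷ []) = PASS (y₁ ∷ y₂ ∷ y₃ ∷ y₄ ∷ [])
PRE (true ∷ false ∷ true ∷ false ∷ true ∷ true ∷ []) = 1ℤ
PRE (true ∷ true ∷ true ∷ true ∷ true ∷ true ∷ []) = 1ℤ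
PRE (true ∷ false ∷ false ∷ false ∷ false ∷ true ∷ []) = 1ℤ
PRE (true ∷ true ∷ false ∷ true ∷ false ∷ true ∷ []) = 1ℤ
PRE (false ∷ false ∷ true ∷ false ∷ true ∷ false ∷ []) = 1ℤ
PRE (false ∷ true ∷ true ∷ true ∷ true ∷ false ∷ []) = 1ℤ
PRE _ = 0ℤ

-- The gate Γ(A).  A ⊆ [n]² is given by its (decidable) membership
-- function; (i , j) ∈ A  iff  A i j ≡ true.  Indices i (row), j (column)
-- range over Fin n (Fin.zero = 1 in the paper).

data GVtx (n : ℕ) : Set where
  b  : Fin n → Fin n → GVtx n
  a₁ : GVtx n
  a₂ : GVtx n

-- dangling edges: north of b_{1,j}, east of b_{i,n}, south of b_{n,j}, west of b_{i,1}
data GDang (n : ℕ) : Set where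
  dN dE dS dW : Fin n → GDang n

data Kind : Set where
  vert horiz ap₁ ap₂ : Kind

_≟K_ : DecidableEquality Kind
vert ≟K vert = yes refl
vert ≟K horiz = no λ ()
vert ≟K ap₁ = no λ ()
vert ≟K ap₂ = no λ ()
horiz ≟K vert = no λ ()
horiz ≟K horiz = yes refl
horiz ≟K ap₁ = no λ ()
horiz ≟K ap₂ = no λ ()
ap₁ ≟K vert = no λ ()
ap₁ ≟K horiz = no λ ()
ap₁ ≟K ap₁ = yes refl
ap₁ ≟K ap₂ = no λ ()
ap₂ ≟K vert = no λ ()
ap₂ ≟K horiz = no λ ()
ap₂ ≟K ap₁ = no λ ()
ap₂ ≟K ap₂ = yes refl

-- internal edges: (vert , i , j) joins the south edge of b_{i,j} and the
-- north edge of b_{i+1,j} (present iff i < n); (horiz , i , j) joins the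
-- east edge of b_{i,j} and the west edge of b_{i,j+1} (present iff j < n);
-- (apₖ , i , j) is the edge a_k b_{i,j} (present iff (i,j) ∈ A).
GEdge : ℕ → Set
GEdge n = Kind × Fin n × Fin n

_≟GE_ : ∀ {n} → DecidableEquality (GEdge n)
_≟GE_ = ≡-dec _≟K_ (≡-dec Fin._≟_ Fin._≟_)

isLast : ∀ {n} → Fin n → Bool
isLast {n} i = suc (toℕ i) ≡ᵇ n

cells : (n : ℕ) → List (Fin n × Fin n)
cells n = cartesianProduct (allFin n) (allFin n)

module Grid (n : ℕ) (A : Fin n → Fin n → Bool) where

  northE : Fin n → Fin n → GDang n ⊎ GEdge n
  northE Fin.zero j = inj₁ (dN j)
  northE (Fin.suc i) j = inj₂ (vert , inject₁ i , j)

  westE : Fin n → Fin n → GDang n ⊎ GEdge n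
  westE i Fin.zero = inj₁ (dW i)
  westE i (Fin.suc j) = inj₂ (horiz , i , inject₁ j)

  eastE : Fin n → Fin n → GDang n ⊎ GEdge n
  eastE i j = if isLast j then inj₁ (dE i) else inj₂ (horiz , i , j)

  southE : Fin n → Fin n → GDang n ⊎ GEdge n
  southE i j = if isLast i then inj₁ (dS j) else inj₂ (vert , i , j)

  inA : Fin n × Fin n → Bool
  inA (i , j) = A i j

  incG : GVtx n → List (GDang n ⊎ GEdge n)
  incG (b i j) = northE i j ∷ eastE i j ∷ southE i j ∷ westE i j ∷
    (if A i j then inj₂ (ap₁ , i , j) ∷ inj₂ (ap₂ , i , j) ∷ [] else [])
  incG a₁ = map (λ { (i , j) → inj₂ (ap₁ , i , j) }) (filterᵇ inA (cells n))
  incG a₂ = map (λ { (i , j) → inj₂ (ap₂ , i , j) }) (filterᵇ inA (cells n))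

  fG : GVtx n → List Bool → ℤ
  fG (b i j) = if A i j then PRE else PASS
  fG a₁ = HW₌₁
  fG a₂ = HW₌₁

  internalG : List (GEdge n)
  internalG =
       map (λ { (i , j) → (vert , i , j) })  (filterᵇ (λ { (i , j) → not (isLast i) }) (cells n))
    ++ map (λ { (i , j) → (horiz , i , j) }) (filterᵇ (λ { (i , j) → not (isLast j) }) (cells n))
    ++ map (λ { (i , j) → (ap₁ , i , j) })   (filterᵇ inA (cells n))
    ++ map (λ { (i , j) → (ap₂ , i , j) })   (filterᵇ inA (cells n))

  vtxsG : List (GVtx n)
  vtxsG = map (λ { (i , j) → b i j }) (cells n) ++ (a₁ ∷ a₂ ∷ [])

Γ : (n : ℕ) → (Fin n → Fin n → Bool) → Gate
Γ n A = record
  { Vtx = GVtx n ; vtxs = vtxsG ; Edge = GEdge n ; _≟E_ = _≟GE_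
  ; internal = internalG ; Dang = GDang n ; inc = incG ; f = fG ; w = λ _ → 1ℤ }
  where open Grid n A

module _ {n : ℕ} (x : GDang n → Bool) where
  xN xE xS xW : Fin n → Bool
  xN j = x (dN j)
  xE i = x (dE i)
  xS j = x (dS j)
  xW i = x (dW i)

hwF : ∀ {n} → (Fin n → Bool) → ℕ
hwF {n} s = hw (map s (allFin n))

-- the string s is 0^{v-1} 1 0^{n-v}, i.e. s is identified with v ∈ [n]
_isIdx_ : ∀ {n} → (Fin n → Bool) → Fin n → Set
s isIdx v = ∀ i → s i ≡ does (i Fin.≟ v)

_≐_ : ∀ {n} → (Fin n → Bool) → (Fin n → Bool) → Set
s ≐ t = ∀ i → s i ≡ t i

φone : ∀ {n} → (GDang n → Bool) → Set
φone x = (hwF (xN x) ≡ 1) × (hwF (xW x) ≡ 1)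

φprop : ∀ {n} → (GDang n → Bool) → Set
φprop x = (xN x ≐ xS x) × (xW x ≐ xE x)

module Quantities {n : ℕ} (A : Fin n → Fin n → Bool) where

  countℤ : (Fin n → Bool) → ℤ
  countℤ P = + hw (map P (allFin n))

  sumFin : (Fin n → ℤ) → ℤ
  sumFin g = sumℤ (map g (allFin n))

  αℕ βℕ : Fin n → Fin n → ℕ
  αℕ u v = hw (map (λ i → (toℕ i <ᵇ toℕ u) ∧ A i v) (allFin n))
  βℕ u v = hw (map (λ i → (toℕ u <ᵇ toℕ i) ∧ A i v) (allFin n))

  α β : Fin n → Fin n → ℤ
  α u v = + αℕ u v
  β u v = + βℕ u v

  q : Fin n → ℤ
  q u = sumFin λ z → α u z * β u z - + (αℕ u z C 2) - + (βℕ u z C 2)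

  p : Fin n → Fin n → Fin n → ℤ
  p u v w = (α u v - β u v) * (β u w - α u w)

  r s : Fin n → Fin n → ℤ
  r u v = sumFin λ z → if not (does (z Fin.≟ v)) ∧ A u z then β u z else 0ℤ
  s u v = sumFin λ z → if not (does (z Fin.≟ v)) ∧ A u z then α u z else 0ℤ

-- Both apices have signature HW₌₁, so Sig(Γ(A), x) is a sum over the cells t₁, t₂ ∈ A
-- holding the unique edges to a₁ and a₂. A vertex of nonzero weight has east = west and
-- south = north ⊕ (its apex edges), so for fixed t₁, t₂ at most one assignment of the
-- grid edges contributes: every row carries x_W (hence Sig = 0 unless x_W = x_E) and
-- every column carries x_N, flipped at t₁ and t₂. The contribution factors over the
-- columns. Recording with s (t) the column that holds t₁ (t₂), Sig is the coefficient
-- of st in the product of column polynomials over ℤ[s,t]/(s², t²). A transfer-matrix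
-- induction down a column shows that its polynomial depends only on its boundary values
-- and on the numbers of cells of A above and below the row u of x_W; the three cases of
-- the theorem correspond to which columns have nonzero boundary values.

module Submission where

open import Defs
open import Algebra.Bundles using (CommutativeMonoid; Monoid)
import Algebra.Properties.CommutativeMonoid.Sum as CommutativeMonoidSum
open import Data.Bool using (Bool; true; false; if_then_else_; _∧_; _∨_; not; _xor_; T)
import Data.Bool as Bool
open import Data.Bool.Properties
  using (T-∧; T-≡; not-¬; ¬-not; not-involutive; ∧-zeroʳ; ∧-identityʳ; ∧-assoc; ∧-idem)
open import Data.Empty using (⊥-elim)
open import Data.Fin as Fin using (Fin; toℕ; inject₁; fromℕ)
open import Data.Fin.Properties using (punchInᵢ≢i; toℕ-inject₁; any?; all?; ¬∀⟶∃¬)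
open import Data.Integer as ℤ using (ℤ; +_; -_; _+_; _-_; _*_; 0ℤ; 1ℤ)
import Data.Integer.Properties as ℤP
open import Data.Integer.Tactic.RingSolver using (solve-∀)
open import Data.List using (List; []; _∷_; map; foldr; _++_; filterᵇ; allFin; cartesianProduct; tabulate)
import Data.List.Properties as Listₚ
open import Data.List.Membership.Propositional using (_∈_; _∉_)
open import Data.List.Membership.Propositional.Properties
  using (∈-map⁺; ∈-map⁻; ∈-filter⁺; ∈-filter⁻; ∈-cartesianProduct⁺; ∈-++⁺ˡ; ∈-++⁺ʳ; ∈-++⁻; ∈-allFin)
open import Data.List.Relation.Unary.Any using (here; there)
import Data.List.Relation.Unary.All as All
open import Data.List.Relation.Unary.All.Properties using (All¬⇒¬Any)
open import Data.List.Relation.Unary.AllPairs using (_∷_)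
open import Data.List.Relation.Unary.Unique.Propositional using (Unique)
import Data.List.Relation.Unary.Unique.Propositional.Properties as Uniqueₚ
open import Data.Maybe using (Maybe; just; nothing)
open import Data.Nat as ℕ using (ℕ; zero; suc; _<ᵇ_)
open import Data.Nat.Combinatorics using (_C_; nC1≡n; nCk+nC[k+1]≡[n+1]C[k+1])
import Data.Nat.Properties as ℕP
open import Data.Product using (_×_; _,_; proj₁; proj₂; ∃)
open import Data.Product.Properties using (≡-dec)
open import Data.Sum using (_⊎_; inj₁; inj₂; [_,_])
open import Data.Unit using (tt)
open import Data.Vec.Functional using (Vector; removeAt)
open import Function using (_∘_)
open import Function.Bundles using (Equivalence)
open import Level using (0ℓ)
open import Relation.Binary.Definitions using (DecidableEquality)
open import Relation.Binary.PropositionalEquality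
  using (_≡_; _≢_; refl; sym; trans; cong; cong₂; subst; _≗_; isEquivalence; module ≡-Reasoning)
open import Relation.Nullary using (yes; no; does; ¬_)
open import Relation.Nullary.Decidable using (dec-true; dec-false; decidable-stable; T?)
open import Algebra.Properties.Semiring.Sum ℤP.+-*-semiring
  using (∑-distrib-+; ∑-comm; *-distribˡ-sum; *-distribʳ-sum) renaming (sum to ∑; sum-cong-≗ to ∑-cong)
open CommutativeMonoidSum ℤP.*-1-commutativeMonoid
  using () renaming (sum to ∏; sum-cong-≗ to ∏-cong; ∑-comm to ∏-comm)

erase : ∀ {a} {A : Set a} {n} → A → Vector A n → Fin n → Vector A n
erase z t i j = if does (j Fin.≟ i) then z else t j

module _ {a ℓ} (M : CommutativeMonoid a ℓ) where
  open CommutativeMonoid M using (Carrier; _≈_; _∙_; ε; ∙-congˡ; ∙-congʳ; identityˡ; setoid; reflexive)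
  open CommutativeMonoidSum M using (sum; sum-remove; sum-cong-≋)
  open import Relation.Binary.Reasoning.Setoid setoid

  sum-erase : ∀ {n} (t : Vector Carrier (suc n)) i → sum t ≈ t i ∙ sum (erase ε t i)
  sum-erase t i = begin
    sum t                     ≈⟨ sum-remove {i = i} t ⟩
    t i ∙ sum (removeAt t i)  ≈⟨ ∙-congˡ rest ⟩
    t i ∙ sum (erase ε t i)   ∎
    where
    kept : ∀ j → t (Fin.punchIn i j) ≡ erase ε t i (Fin.punchIn i j)
    kept j rewrite dec-false (Fin.punchIn i j Fin.≟ i) (punchInᵢ≢i i j) = refl
    erased : ε ≡ erase ε t i i
    erased rewrite dec-true (i Fin.≟ i) refl = refl
    rest : sum (removeAt t i) ≈ sum (erase ε t i)
    rest = begin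
      sum (removeAt t i)                          ≈⟨ sum-cong-≋ (reflexive ∘ kept) ⟩
      sum (removeAt (erase ε t i) i)              ≈⟨ identityˡ _ ⟨
      ε ∙ sum (removeAt (erase ε t i) i)          ≈⟨ ∙-congʳ (reflexive erased) ⟩
      erase ε t i i ∙ sum (removeAt (erase ε t i) i) ≈⟨ sum-remove {i = i} (erase ε t i) ⟨
      sum (erase ε t i)                           ∎

when : Bool → ℤ → ℤ
when c z = if c then z else 0ℤ

when-*ˡ : ∀ c x y → when c (x * y) ≡ x * when c y
when-*ˡ true  x y = refl
when-*ˡ false x y = sym (ℤP.*-zeroʳ x)

when-*ʳ : ∀ c x y → when c (x * y) ≡ when c x * y
when-*ʳ true  x y = refl
when-*ʳ false x y = sym (ℤP.*-zeroˡ y)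

when-+ : ∀ c x y → when c (x + y) ≡ when c x + when c y
when-+ true  x y = refl
when-+ false x y = refl

∑⟨_⟩ : ∀ {n} → (Fin n → Bool) → (Fin n → ℤ) → ℤ
∑⟨ g ⟩ F = ∑ λ i → when (g i) (F i)

∑∑⟨_⟩ : ∀ {k n} → (Fin k → Fin n → Bool) → (Fin k → Fin n → ℤ) → ℤ
∑∑⟨ w ⟩ F = ∑ λ j → ∑⟨ w j ⟩ (F j)

∑⟨⟩-*ˡ : ∀ {n} (g : Fin n → Bool) a F → ∑⟨ g ⟩ (λ i → a * F i) ≡ a * ∑⟨ g ⟩ F
∑⟨⟩-*ˡ g a F = trans (∑-cong λ i → when-*ˡ (g i) a (F i)) (sym (*-distribˡ-sum a (λ i → when (g i) (F i))))

∑⟨⟩-*ʳ : ∀ {n} (g : Fin n → Bool) F a → ∑⟨ g ⟩ (λ i → F i * a) ≡ ∑⟨ g ⟩ F * a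
∑⟨⟩-*ʳ g F a = trans (∑-cong λ i → when-*ʳ (g i) (F i) a) (sym (*-distribʳ-sum a (λ i → when (g i) (F i))))

∑⟨⟩-+ : ∀ {n} (g : Fin n → Bool) F G → ∑⟨ g ⟩ (λ i → F i + G i) ≡ ∑⟨ g ⟩ F + ∑⟨ g ⟩ G
∑⟨⟩-+ g F G = trans (∑-cong λ i → when-+ (g i) (F i) (G i)) (∑-distrib-+ (λ i → when (g i) (F i)) (λ i → when (g i) (G i)))

∑∑⟨⟩-*ˡ : ∀ {k n} (w : Fin k → Fin n → Bool) a F → ∑∑⟨ w ⟩ (λ j i → a * F j i) ≡ a * ∑∑⟨ w ⟩ F
∑∑⟨⟩-*ˡ w a F = trans (∑-cong λ j → ∑⟨⟩-*ˡ (w j) a (F j)) (sym (*-distribˡ-sum a (λ j → ∑⟨ w j ⟩ (F j))))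

∑∑⟨⟩-+ : ∀ {k n} (w : Fin k → Fin n → Bool) F G → ∑∑⟨ w ⟩ (λ j i → F j i + G j i) ≡ ∑∑⟨ w ⟩ F + ∑∑⟨ w ⟩ G
∑∑⟨⟩-+ w F G = trans (∑-cong λ j → ∑⟨⟩-+ (w j) (F j) (G j)) (∑-distrib-+ (λ j → ∑⟨ w j ⟩ (F j)) (λ j → ∑⟨ w j ⟩ (G j)))

-- ℤ[s,t]/(s², t²). A column polynomial has its s-coefficient (t-coefficient) from the
-- configurations in which the column holds the edge to the first (second) apex.
record ℤst : Set where
  constructor ⟨_,_,_,_⟩
  field
    c₁ cₛ cₜ cₛₜ : ℤ
open ℤst public

infixl 7 _⊗_
_⊗_ : ℤst → ℤst → ℤst
⟨ x₁ , xₛ , xₜ , xₛₜ ⟩ ⊗ ⟨ y₁ , yₛ , yₜ , yₛₜ ⟩ =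
  ⟨ x₁ * y₁ , x₁ * yₛ + xₛ * y₁ , x₁ * yₜ + xₜ * y₁ , x₁ * yₛₜ + xₛ * yₜ + xₜ * yₛ + xₛₜ * y₁ ⟩

𝟙 : ℤst
𝟙 = ⟨ 1ℤ , 0ℤ , 0ℤ , 0ℤ ⟩

⟨⟩-cong : ∀ {x₁ xₛ xₜ xₛₜ y₁ yₛ yₜ yₛₜ} → x₁ ≡ y₁ → xₛ ≡ yₛ → xₜ ≡ yₜ → xₛₜ ≡ yₛₜ →
          ⟨ x₁ , xₛ , xₜ , xₛₜ ⟩ ≡ ⟨ y₁ , yₛ , yₜ , yₛₜ ⟩
⟨⟩-cong refl refl refl refl = refl

⊗-comm : ∀ x y → x ⊗ y ≡ y ⊗ x
⊗-comm ⟨ x₁ , xₛ , xₜ , xₛₜ ⟩ ⟨ y₁ , yₛ , yₜ , yₛₜ ⟩ =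
  ⟨⟩-cong (ℤP.*-comm x₁ y₁) (linear x₁ xₛ y₁ yₛ) (linear x₁ xₜ y₁ yₜ) (quadratic x₁ xₛ xₜ xₛₜ y₁ yₛ yₜ yₛₜ)
  where
  linear : ∀ x₁ a y₁ b → x₁ * b + a * y₁ ≡ y₁ * a + b * x₁
  linear = solve-∀
  quadratic : ∀ x₁ xₛ xₜ xₛₜ y₁ yₛ yₜ yₛₜ →
              x₁ * yₛₜ + xₛ * yₜ + xₜ * yₛ + xₛₜ * y₁ ≡ y₁ * xₛₜ + yₛ * xₜ + yₜ * xₛ + yₛₜ * x₁
  quadratic = solve-∀

⊗-assoc : ∀ x y z → (x ⊗ y) ⊗ z ≡ x ⊗ (y ⊗ z)
⊗-assoc ⟨ x₁ , xₛ , xₜ , xₛₜ ⟩ ⟨ y₁ , yₛ , yₜ , yₛₜ ⟩ ⟨ z₁ , zₛ , zₜ , zₛₜ ⟩ =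
  ⟨⟩-cong (ℤP.*-assoc x₁ y₁ z₁) (linear x₁ xₛ y₁ yₛ z₁ zₛ) (linear x₁ xₜ y₁ yₜ z₁ zₜ)
          (quadratic x₁ xₛ xₜ xₛₜ y₁ yₛ yₜ yₛₜ z₁ zₛ zₜ zₛₜ)
  where
  linear : ∀ x₁ a y₁ b z₁ c → x₁ * y₁ * c + (x₁ * b + a * y₁) * z₁ ≡ x₁ * (y₁ * c + b * z₁) + a * (y₁ * z₁)
  linear = solve-∀
  quadratic : ∀ x₁ xₛ xₜ xₛₜ y₁ yₛ yₜ yₛₜ z₁ zₛ zₜ zₛₜ →
    x₁ * y₁ * zₛₜ + (x₁ * yₛ + xₛ * y₁) * zₜ + (x₁ * yₜ + xₜ * y₁) * zₛ + (x₁ * yₛₜ + xₛ * yₜ + xₜ * yₛ + xₛₜ * y₁) * z₁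
    ≡ x₁ * (y₁ * zₛₜ + yₛ * zₜ + yₜ * zₛ + yₛₜ * z₁) + xₛ * (y₁ * zₜ + yₜ * z₁) + xₜ * (y₁ * zₛ + yₛ * z₁) + xₛₜ * (y₁ * z₁)
  quadratic = solve-∀

⊗-identityˡ : ∀ x → 𝟙 ⊗ x ≡ x
⊗-identityˡ ⟨ x₁ , xₛ , xₜ , xₛₜ ⟩ =
  ⟨⟩-cong (ℤP.*-identityˡ x₁) (linear x₁ xₛ) (linear x₁ xₜ) (quadratic x₁ xₛ xₜ xₛₜ)
  where
  linear : ∀ x₁ a → 1ℤ * a + 0ℤ * x₁ ≡ a
  linear = solve-∀
  quadratic : ∀ x₁ xₛ xₜ xₛₜ → 1ℤ * xₛₜ + 0ℤ * xₜ + 0ℤ * xₛ + 0ℤ * x₁ ≡ xₛₜ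
  quadratic = solve-∀

ℤst-commutativeMonoid : CommutativeMonoid 0ℓ 0ℓ
ℤst-commutativeMonoid = record
  { Carrier = ℤst
  ; _≈_ = _≡_
  ; _∙_ = _⊗_
  ; ε = 𝟙
  ; isCommutativeMonoid = record
    { isMonoid = record
      { isSemigroup = record
        { isMagma = record { isEquivalence = isEquivalence ; ∙-cong = cong₂ _⊗_ }
        ; assoc = ⊗-assoc
        }
      ; identity = ⊗-identityˡ , λ x → trans (⊗-comm x 𝟙) (⊗-identityˡ x)
      }
    ; comm = ⊗-comm
    }
  }

open CommutativeMonoidSum ℤst-commutativeMonoid using () renaming (sum to ∏⊗; sum-cong-≗ to ∏⊗-cong)

∏⊗-extract : ∀ {k} (T : Fin (suc k) → ℤst) j → ∏⊗ T ≡ T j ⊗ ∏⊗ (erase 𝟙 T j)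
∏⊗-extract = sum-erase ℤst-commutativeMonoid

∏⊗-diagonal : ∀ {k} (X : Fin k → ℤ) → ∏⊗ (λ j → ⟨ 1ℤ , 0ℤ , 0ℤ , X j ⟩) ≡ ⟨ 1ℤ , 0ℤ , 0ℤ , ∑ X ⟩
∏⊗-diagonal {zero}  X = refl
∏⊗-diagonal {suc k} X rewrite ∏⊗-diagonal (X ∘ Fin.suc) = ⟨⟩-cong refl refl refl (lemma (X Fin.zero) (∑ (X ∘ Fin.suc)))
  where
  lemma : ∀ x y → 1ℤ * y + 0ℤ * 0ℤ + 0ℤ * 0ℤ + x * 1ℤ ≡ x + y
  lemma = solve-∀

∏⊗-cₛ-zero : ∀ {k} (T : Fin k → ℤst) → (∀ j → cₛ (T j) ≡ 0ℤ) → cₛ (∏⊗ T) ≡ 0ℤ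
∏⊗-cₛ-zero {zero}  T _ = refl
∏⊗-cₛ-zero {suc k} T cₛ≡0
  with T Fin.zero | cₛ≡0 Fin.zero | ∏⊗ (T ∘ Fin.suc) | ∏⊗-cₛ-zero (T ∘ Fin.suc) (cₛ≡0 ∘ Fin.suc)
... | ⟨ x₁ , _ , _ , _ ⟩ | refl | ⟨ y₁ , _ , _ , _ ⟩ | refl = lemma x₁ y₁
  where
  lemma : ∀ x₁ y₁ → x₁ * 0ℤ + 0ℤ * y₁ ≡ 0ℤ
  lemma = solve-∀

∏⊗-cₜ-zero : ∀ {k} (T : Fin k → ℤst) → (∀ j → cₜ (T j) ≡ 0ℤ) → cₜ (∏⊗ T) ≡ 0ℤ
∏⊗-cₜ-zero {zero}  T _ = refl
∏⊗-cₜ-zero {suc k} T cₜ≡0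
  with T Fin.zero | cₜ≡0 Fin.zero | ∏⊗ (T ∘ Fin.suc) | ∏⊗-cₜ-zero (T ∘ Fin.suc) (cₜ≡0 ∘ Fin.suc)
... | ⟨ x₁ , _ , _ , _ ⟩ | refl | ⟨ y₁ , _ , _ , _ ⟩ | refl = lemma x₁ y₁
  where
  lemma : ∀ x₁ y₁ → x₁ * 0ℤ + 0ℤ * y₁ ≡ 0ℤ
  lemma = solve-∀

mark : ∀ {k n} → Fin k → Fin n → Fin k → Maybe (Fin n)
mark j₀ i₀ j = if does (j₀ Fin.≟ j) then just i₀ else nothing

tuple : ∀ {n} → (Fin n → Bool) → (Maybe (Fin n) → Maybe (Fin n) → ℤ) → ℤst
tuple c K = ⟨ K nothing nothing
            , ∑⟨ c ⟩ (λ i → K (just i) nothing)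
            , ∑⟨ c ⟩ (λ i → K nothing (just i))
            , ∑⟨ c ⟩ (λ i₂ → ∑⟨ c ⟩ λ i₁ → K (just i₁) (just i₂)) ⟩

module _ {n : ℕ} where

  Weights : ℕ → Set
  Weights k = Fin k → Maybe (Fin n) → Maybe (Fin n) → ℤ

  ∏tuple-c₁ : ∀ {k} (w : Fin k → Fin n → Bool) (K : Weights k) →
              c₁ (∏⊗ λ j → tuple (w j) (K j)) ≡ ∏ λ j → K j nothing nothing
  ∏tuple-c₁ {zero}  w K = refl
  ∏tuple-c₁ {suc k} w K = cong (K Fin.zero nothing nothing *_) (∏tuple-c₁ (w ∘ Fin.suc) (K ∘ Fin.suc))

  ∏tuple-cₛ : ∀ {k} (w : Fin k → Fin n → Bool) (K : Weights k) →
              cₛ (∏⊗ λ j → tuple (w j) (K j)) ≡ ∑∑⟨ w ⟩ λ j₁ i₁ → ∏ λ j → K j (mark j₁ i₁ j) nothing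
  ∏tuple-cₛ {zero}  w K = refl
  ∏tuple-cₛ {suc k} w K = begin
      K₀ nothing nothing * cₛ P + Σₛ * c₁ P
    ≡⟨ cong₂ _+_ (cong (K₀ nothing nothing *_) (∏tuple-cₛ w' K')) (cong (Σₛ *_) (∏tuple-c₁ w' K')) ⟩
      K₀ nothing nothing * R + Σₛ * P₀
    ≡⟨ ℤP.+-comm (K₀ nothing nothing * R) (Σₛ * P₀) ⟩
      Σₛ * P₀ + K₀ nothing nothing * R
    ≡⟨ cong₂ _+_ (∑⟨⟩-*ʳ (w Fin.zero) (λ i → K₀ (just i) nothing) P₀)
                 (∑∑⟨⟩-*ˡ w' (K₀ nothing nothing) λ j₁ i₁ → ∏ λ j → K' j (mark j₁ i₁ j) nothing) ⟨
      ∑∑⟨ w ⟩ (λ j₁ i₁ → ∏ λ j → K j (mark j₁ i₁ j) nothing)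
    ∎
    where
    open ≡-Reasoning
    w' = w ∘ Fin.suc
    K' = K ∘ Fin.suc
    K₀ = K Fin.zero
    P = ∏⊗ λ j → tuple (w' j) (K' j)
    P₀ = ∏ λ j → K' j nothing nothing
    Σₛ = ∑⟨ w Fin.zero ⟩ λ i → K₀ (just i) nothing
    R = ∑∑⟨ w' ⟩ λ j₁ i₁ → ∏ λ j → K' j (mark j₁ i₁ j) nothing

  ∏tuple-cₜ : ∀ {k} (w : Fin k → Fin n → Bool) (K : Weights k) →
              cₜ (∏⊗ λ j → tuple (w j) (K j)) ≡ ∑∑⟨ w ⟩ λ j₂ i₂ → ∏ λ j → K j nothing (mark j₂ i₂ j)
  ∏tuple-cₜ {zero}  w K = refl
  ∏tuple-cₜ {suc k} w K = begin
      K₀ nothing nothing * cₜ P + Σₜ * c₁ P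
    ≡⟨ cong₂ _+_ (cong (K₀ nothing nothing *_) (∏tuple-cₜ w' K')) (cong (Σₜ *_) (∏tuple-c₁ w' K')) ⟩
      K₀ nothing nothing * R + Σₜ * P₀
    ≡⟨ ℤP.+-comm (K₀ nothing nothing * R) (Σₜ * P₀) ⟩
      Σₜ * P₀ + K₀ nothing nothing * R
    ≡⟨ cong₂ _+_ (∑⟨⟩-*ʳ (w Fin.zero) (λ i → K₀ nothing (just i)) P₀)
                 (∑∑⟨⟩-*ˡ w' (K₀ nothing nothing) λ j₂ i₂ → ∏ λ j → K' j nothing (mark j₂ i₂ j)) ⟨
      ∑∑⟨ w ⟩ (λ j₂ i₂ → ∏ λ j → K j nothing (mark j₂ i₂ j))
    ∎
    where
    open ≡-Reasoning
    w' = w ∘ Fin.suc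
    K' = K ∘ Fin.suc
    K₀ = K Fin.zero
    P = ∏⊗ λ j → tuple (w' j) (K' j)
    P₀ = ∏ λ j → K' j nothing nothing
    Σₜ = ∑⟨ w Fin.zero ⟩ λ i → K₀ nothing (just i)
    R = ∑∑⟨ w' ⟩ λ j₂ i₂ → ∏ λ j → K' j nothing (mark j₂ i₂ j)

  ∏tuple-cₛₜ : ∀ {k} (w : Fin k → Fin n → Bool) (K : Weights k) →
               cₛₜ (∏⊗ λ j → tuple (w j) (K j))
               ≡ ∑∑⟨ w ⟩ λ j₂ i₂ → ∑∑⟨ w ⟩ λ j₁ i₁ → ∏ λ j → K j (mark j₁ i₁ j) (mark j₂ i₂ j)
  ∏tuple-cₛₜ {zero}  w K = refl
  -- Split by whether column 0 holds the second apex edge (top) or not (rest).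
  ∏tuple-cₛₜ {suc k} w K = begin
      K₀ nothing nothing * cₛₜ P + Σₛ * cₜ P + Σₜ * cₛ P + Σₛₜ * c₁ P
    ≡⟨ cong₂ _+_ (cong₂ _+_ (cong₂ _+_ (cong (K₀ nothing nothing *_) (∏tuple-cₛₜ w' K'))
                                      (cong (Σₛ *_) (∏tuple-cₜ w' K')))
                            (cong (Σₜ *_) (∏tuple-cₛ w' K')))
                 (cong (Σₛₜ *_) (∏tuple-c₁ w' K')) ⟩
      K₀ nothing nothing * Rₛₜ + Σₛ * Rₜ + Σₜ * Rₛ + Σₛₜ * P₀
    ≡⟨ regroup (K₀ nothing nothing) Rₛₜ Σₛ Rₜ Σₜ Rₛ Σₛₜ P₀ ⟩
      (Σₛₜ * P₀ + Σₜ * Rₛ) + (Σₛ * Rₜ + K₀ nothing nothing * Rₛₜ)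
    ≡⟨ cong₂ _+_ top rest ⟨
      ∑∑⟨ w ⟩ (λ j₂ i₂ → ∑∑⟨ w ⟩ λ j₁ i₁ → ∏ λ j → K j (mark j₁ i₁ j) (mark j₂ i₂ j))
    ∎
    where
    open ≡-Reasoning
    w' = w ∘ Fin.suc
    K' = K ∘ Fin.suc
    K₀ = K Fin.zero
    w₀ = w Fin.zero
    P = ∏⊗ λ j → tuple (w' j) (K' j)
    P₀ = ∏ λ j → K' j nothing nothing
    Σₛ = ∑⟨ w₀ ⟩ λ i → K₀ (just i) nothing
    Σₜ = ∑⟨ w₀ ⟩ λ i → K₀ nothing (just i)
    Σₛₜ = ∑⟨ w₀ ⟩ λ i₂ → ∑⟨ w₀ ⟩ λ i₁ → K₀ (just i₁) (just i₂)
    Rₛ = ∑∑⟨ w' ⟩ λ j₁ i₁ → ∏ λ j → K' j (mark j₁ i₁ j) nothing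
    Rₜ = ∑∑⟨ w' ⟩ λ j₂ i₂ → ∏ λ j → K' j nothing (mark j₂ i₂ j)
    Rₛₜ = ∑∑⟨ w' ⟩ λ j₂ i₂ → ∑∑⟨ w' ⟩ λ j₁ i₁ → ∏ λ j → K' j (mark j₁ i₁ j) (mark j₂ i₂ j)

    regroup : ∀ a b c d e f g h → a * b + c * d + e * f + g * h ≡ (g * h + e * f) + (c * d + a * b)
    regroup = solve-∀

    top : ∑⟨ w₀ ⟩ (λ i₂ → ∑⟨ w₀ ⟩ (λ i₁ → K₀ (just i₁) (just i₂) * P₀)
                        + ∑∑⟨ w' ⟩ (λ j₁ i₁ → K₀ nothing (just i₂) * ∏ λ j → K' j (mark j₁ i₁ j) nothing))
          ≡ Σₛₜ * P₀ + Σₜ * Rₛ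
    top = begin
        ∑⟨ w₀ ⟩ (λ i₂ → ∑⟨ w₀ ⟩ (λ i₁ → K₀ (just i₁) (just i₂) * P₀)
                      + ∑∑⟨ w' ⟩ (λ j₁ i₁ → K₀ nothing (just i₂) * ∏ λ j → K' j (mark j₁ i₁ j) nothing))
      ≡⟨ ∑-cong (λ i₂ → cong (when (w₀ i₂)) (cong₂ _+_
           (∑⟨⟩-*ʳ w₀ (λ i₁ → K₀ (just i₁) (just i₂)) P₀)
           (∑∑⟨⟩-*ˡ w' (K₀ nothing (just i₂)) λ j₁ i₁ → ∏ λ j → K' j (mark j₁ i₁ j) nothing))) ⟩
        ∑⟨ w₀ ⟩ (λ i₂ → (∑⟨ w₀ ⟩ λ i₁ → K₀ (just i₁) (just i₂)) * P₀ + K₀ nothing (just i₂) * Rₛ)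
      ≡⟨ ∑⟨⟩-+ w₀ (λ i₂ → (∑⟨ w₀ ⟩ λ i₁ → K₀ (just i₁) (just i₂)) * P₀) (λ i₂ → K₀ nothing (just i₂) * Rₛ) ⟩
        ∑⟨ w₀ ⟩ (λ i₂ → (∑⟨ w₀ ⟩ λ i₁ → K₀ (just i₁) (just i₂)) * P₀) + ∑⟨ w₀ ⟩ (λ i₂ → K₀ nothing (just i₂) * Rₛ)
      ≡⟨ cong₂ _+_ (∑⟨⟩-*ʳ w₀ (λ i₂ → ∑⟨ w₀ ⟩ λ i₁ → K₀ (just i₁) (just i₂)) P₀)
                   (∑⟨⟩-*ʳ w₀ (λ i₂ → K₀ nothing (just i₂)) Rₛ) ⟩
        Σₛₜ * P₀ + Σₜ * Rₛ
      ∎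

    rest : ∑∑⟨ w' ⟩ (λ j₂ i₂ → ∑⟨ w₀ ⟩ (λ i₁ → K₀ (just i₁) nothing * ∏ λ j → K' j nothing (mark j₂ i₂ j))
                            + ∑∑⟨ w' ⟩ (λ j₁ i₁ → K₀ nothing nothing * ∏ λ j → K' j (mark j₁ i₁ j) (mark j₂ i₂ j)))
           ≡ Σₛ * Rₜ + K₀ nothing nothing * Rₛₜ
    rest = begin
        ∑∑⟨ w' ⟩ (λ j₂ i₂ → ∑⟨ w₀ ⟩ (λ i₁ → K₀ (just i₁) nothing * ∏ λ j → K' j nothing (mark j₂ i₂ j))
                          + ∑∑⟨ w' ⟩ (λ j₁ i₁ → K₀ nothing nothing * ∏ λ j → K' j (mark j₁ i₁ j) (mark j₂ i₂ j)))
      ≡⟨ ∑-cong (λ j₂ → ∑-cong λ i₂ → cong (when (w' j₂ i₂)) (cong₂ _+_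
           (∑⟨⟩-*ʳ w₀ (λ i₁ → K₀ (just i₁) nothing) (∏ λ j → K' j nothing (mark j₂ i₂ j)))
           (∑∑⟨⟩-*ˡ w' (K₀ nothing nothing) λ j₁ i₁ → ∏ λ j → K' j (mark j₁ i₁ j) (mark j₂ i₂ j)))) ⟩
        ∑∑⟨ w' ⟩ (λ j₂ i₂ → Σₛ * (∏ λ j → K' j nothing (mark j₂ i₂ j))
                          + K₀ nothing nothing * ∑∑⟨ w' ⟩ (λ j₁ i₁ → ∏ λ j → K' j (mark j₁ i₁ j) (mark j₂ i₂ j)))
      ≡⟨ ∑∑⟨⟩-+ w' (λ j₂ i₂ → Σₛ * ∏ λ j → K' j nothing (mark j₂ i₂ j))
                   (λ j₂ i₂ → K₀ nothing nothing * ∑∑⟨ w' ⟩ (λ j₁ i₁ → ∏ λ j → K' j (mark j₁ i₁ j) (mark j₂ i₂ j))) ⟩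
        ∑∑⟨ w' ⟩ (λ j₂ i₂ → Σₛ * ∏ λ j → K' j nothing (mark j₂ i₂ j))
        + ∑∑⟨ w' ⟩ (λ j₂ i₂ → K₀ nothing nothing * ∑∑⟨ w' ⟩ (λ j₁ i₁ → ∏ λ j → K' j (mark j₁ i₁ j) (mark j₂ i₂ j)))
      ≡⟨ cong₂ _+_ (∑∑⟨⟩-*ˡ w' Σₛ λ j₂ i₂ → ∏ λ j → K' j nothing (mark j₂ i₂ j))
                   (∑∑⟨⟩-*ˡ w' (K₀ nothing nothing) λ j₂ i₂ → ∑∑⟨ w' ⟩ λ j₁ i₁ → ∏ λ j → K' j (mark j₁ i₁ j) (mark j₂ i₂ j)) ⟩
        Σₛ * Rₜ + K₀ nothing nothing * Rₛₜ
      ∎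

module Assignments {E : Set} (_≟_ : DecidableEquality E) where

  open import Data.List.Membership.DecPropositional _≟_ using (_∈?_)

  Assignment : Set
  Assignment = E → Bool

  set : Assignment → E → Bool → Assignment
  set = update _≟_

  Extensional : (Assignment → ℤ) → Set
  Extensional F = ∀ {g g'} → g ≗ g' → F g ≡ F g'

  AgreeOff : List E → Assignment → Assignment → Set
  AgreeOff es g σ = ∀ e → e ∉ es → g e ≡ σ e

  sumFrom : Assignment → List E → (Assignment → ℤ) → ℤ
  sumFrom σ []       F = F σ
  sumFrom σ (e ∷ es) F = sumFrom σ es (λ g → F (set g e false)) + sumFrom σ es (λ g → F (set g e true))

  sumAssign≡sumFrom : ∀ es F → sumAssign _≟_ es F ≡ sumFrom (λ _ → false) es F
  sumAssign≡sumFrom []       F = refl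
  sumAssign≡sumFrom (e ∷ es) F = cong₂ _+_ (sumAssign≡sumFrom es _) (sumAssign≡sumFrom es _)

  set-≡ : ∀ g e x → set g e x e ≡ x
  set-≡ g e x rewrite dec-true (e ≟ e) refl = refl

  set-≢ : ∀ g e x {e'} → e' ≢ e → set g e x e' ≡ g e'
  set-≢ g e x {e'} e'≢e rewrite dec-false (e' ≟ e) e'≢e = refl

  set-cong : ∀ {g g'} e x → g ≗ g' → set g e x ≗ set g' e x
  set-cong e x g≗g' e' with does (e' ≟ e)
  ... | true  = refl
  ... | false = g≗g' e'

  set-ext : ∀ {F} e x → Extensional F → Extensional (λ g → F (set g e x))
  set-ext e x ext g≗g' = ext (set-cong e x g≗g')

  ∉-∷⁻ : ∀ {e e' : E} {es} → e' ∉ e ∷ es → e' ≢ e × e' ∉ es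
  ∉-∷⁻ e'∉ = (λ p → e'∉ (here p)) , (λ i → e'∉ (there i))

  head∉tail : ∀ {e : E} {es} → Unique (e ∷ es) → e ∉ es
  head∉tail (e≢es ∷ _) = All¬⇒¬Any e≢es

  agreeOff-set : ∀ {es} {g σ : Assignment} e x → AgreeOff es g σ → AgreeOff (e ∷ es) (set g e x) σ
  agreeOff-set {g = g} e x g≈σ e' e'∉ =
    let e'≢e , e'∉es = ∉-∷⁻ e'∉ in trans (set-≢ g e x e'≢e) (g≈σ e' e'∉es)

  map-set-∉ : ∀ g {e} x es → e ∉ es → map (set g e x) es ≡ map g es
  map-set-∉ g x es e∉es =
    Listₚ.map-cong-local (All.tabulate λ e'∈es → set-≢ g _ x λ { refl → e∉es e'∈es })

  sumFrom-cong : ∀ σ es {F G} → (∀ g → AgreeOff es g σ → F g ≡ G g) → sumFrom σ es F ≡ sumFrom σ es G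
  sumFrom-cong σ []       F≈G = F≈G σ (λ _ _ → refl)
  sumFrom-cong σ (e ∷ es) F≈G = cong₂ _+_
    (sumFrom-cong σ es λ g g≈σ → F≈G _ (agreeOff-set e false g≈σ))
    (sumFrom-cong σ es λ g g≈σ → F≈G _ (agreeOff-set e true g≈σ))

  sumFrom-zero : ∀ σ es {F} → (∀ g → AgreeOff es g σ → F g ≡ 0ℤ) → sumFrom σ es F ≡ 0ℤ
  sumFrom-zero σ es F≈0 = trans (sumFrom-cong σ es F≈0) (zeros es)
    where
    zeros : ∀ es → sumFrom σ es (λ _ → 0ℤ) ≡ 0ℤ
    zeros []       = refl
    zeros (e ∷ es) = cong₂ _+_ (zeros es) (zeros es)

  sumFrom-+ : ∀ σ es F G → sumFrom σ es (λ g → F g + G g) ≡ sumFrom σ es F + sumFrom σ es G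
  sumFrom-+ σ []       F G = refl
  sumFrom-+ σ (e ∷ es) F G rewrite sumFrom-+ σ es (λ g → F (set g e false)) (λ g → G (set g e false))
                                 | sumFrom-+ σ es (λ g → F (set g e true)) (λ g → G (set g e true)) =
    interchange (sumFrom σ es (λ g → F (set g e false))) (sumFrom σ es (λ g → G (set g e false)))
                (sumFrom σ es (λ g → F (set g e true))) (sumFrom σ es (λ g → G (set g e true)))
    where
    interchange : ∀ w x y z → w + x + (y + z) ≡ w + y + (x + z)
    interchange = solve-∀

  sumFrom-*ˡ : ∀ σ es c F → sumFrom σ es (λ g → c * F g) ≡ c * sumFrom σ es F
  sumFrom-*ˡ σ []       c F = refl
  sumFrom-*ˡ σ (e ∷ es) c F rewrite sumFrom-*ˡ σ es c (λ g → F (set g e false))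
                                  | sumFrom-*ˡ σ es c (λ g → F (set g e true)) =
    sym (ℤP.*-distribˡ-+ c _ _)

  sumFrom-factorˡ : ∀ σ es (c G : Assignment → ℤ) → (∀ g → AgreeOff es g σ → c g ≡ c σ) →
                    sumFrom σ es (λ g → c g * G g) ≡ c σ * sumFrom σ es G
  sumFrom-factorˡ σ es c G c-const =
    trans (sumFrom-cong σ es λ g g≈σ → cong (_* G g) (c-const g g≈σ)) (sumFrom-*ˡ σ es (c σ) G)

  sumFrom-++ : ∀ σ es fs F → sumFrom σ (es ++ fs) F ≡ sumFrom σ fs (λ h → sumFrom h es F)
  sumFrom-++ σ []       fs F = refl
  sumFrom-++ σ (e ∷ es) fs F =
    trans (cong₂ _+_ (sumFrom-++ σ es fs _) (sumFrom-++ σ es fs _))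
          (sym (sumFrom-+ σ fs (λ h → sumFrom h es (λ g → F (set g e false)))
                               (λ h → sumFrom h es (λ g → F (set g e true)))))

  sumFrom-ext : ∀ es {F} → Extensional F → Extensional (λ σ → sumFrom σ es F)
  sumFrom-ext []       ext σ≗σ' = ext σ≗σ'
  sumFrom-ext (e ∷ es) ext σ≗σ' = cong₂ _+_
    (sumFrom-ext es (set-ext e false ext) σ≗σ') (sumFrom-ext es (set-ext e true ext) σ≗σ')

  sumFrom-delta : ∀ σ es {F} t → Unique es → Extensional F → AgreeOff es t σ →
                  (∀ g → AgreeOff es g σ → F g ≢ 0ℤ → g ≗ t) → sumFrom σ es F ≡ F t
  sumFrom-delta σ []       t _ ext t≈σ _ = ext λ e → sym (t≈σ e λ ())
  sumFrom-delta σ (e ∷ es) {F} t uniq@(_ ∷ uniq') ext t≈σ support = split (t e) refl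
    where
    t' : Assignment
    t' = set t e (σ e)

    t'≈σ : AgreeOff es t' σ
    t'≈σ e' e'∉es with e' ≟ e
    ... | yes refl = refl
    ... | no e'≢e  = t≈σ e' λ { (here p) → e'≢e p ; (there i) → e'∉es i }

    branch : ∀ x → t e ≡ x → sumFrom σ es (λ g → F (set g e x)) ≡ F t
    branch x te≡x = trans (sumFrom-delta σ es t' uniq' (set-ext e x ext) t'≈σ support') (ext restore)
      where
      support' : ∀ g → AgreeOff es g σ → F (set g e x) ≢ 0ℤ → g ≗ t'
      support' g g≈σ F≢0 e' with e' ≟ e | support (set g e x) (agreeOff-set e x g≈σ) F≢0 e'
      ... | yes refl | _   = g≈σ e (head∉tail uniq)
      ... | no _     | g≡t = g≡t

      restore : set t' e x ≗ t
      restore e' with e' ≟ e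
      ... | yes refl = sym te≡x
      ... | no _     = refl

    vanish : ∀ x → t e ≢ x → sumFrom σ es (λ g → F (set g e x)) ≡ 0ℤ
    vanish x te≢x = sumFrom-zero σ es λ g g≈σ → decidable-stable (F (set g e x) ℤ.≟ 0ℤ) λ F≢0 →
      te≢x (trans (sym (support _ (agreeOff-set e x g≈σ) F≢0 e)) (set-≡ g e x))

    split : ∀ y → t e ≡ y → sumFrom σ (e ∷ es) F ≡ F t
    split false te≡y = trans (cong₂ _+_ (branch false te≡y) (vanish true (not-¬ te≡y))) (ℤP.+-identityʳ _)
    split true  te≡y = trans (cong₂ _+_ (vanish false (not-¬ te≡y)) (branch true te≡y)) (ℤP.+-identityˡ _)

  HW₀ : List Bool → ℤ
  HW₀ z = if hw z ℕ.≡ᵇ 0 then 1ℤ else 0ℤ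

  clear : List E → Assignment → Assignment
  clear es σ e = if does (e ∈? es) then false else σ e

  single : List E → Assignment → E → Assignment
  single es σ e e' = if does (e' ∈? es) then does (e' ≟ e) else σ e'

  single-cong : ∀ es {σ σ'} e → σ ≗ σ' → single es σ e ≗ single es σ' e
  single-cong es e σ≗σ' e' with does (e' ∈? es)
  ... | true  = refl
  ... | false = σ≗σ' e'

  sumFrom-HW₀ : ∀ σ es G → Unique es → Extensional G →
                sumFrom σ es (λ g → HW₀ (map g es) * G g) ≡ G (clear es σ)
  sumFrom-HW₀ σ []       G _ ext = trans (ℤP.*-identityˡ (G σ)) (ext λ _ → refl)
  sumFrom-HW₀ σ (e ∷ es) G uniq@(_ ∷ uniq') ext = begin
      sumFrom σ es (λ g → HW₀ (map (set g e false) (e ∷ es)) * G (set g e false))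
    + sumFrom σ es (λ g → HW₀ (map (set g e true) (e ∷ es)) * G (set g e true))
    ≡⟨ cong₂ _+_ (sumFrom-cong σ es λ g _ → cong (λ z → HW₀ z * G (set g e false)) (map-set g false))
                 (sumFrom-zero σ es λ g _ → cong (λ z → HW₀ z * G (set g e true)) (map-set g true)) ⟩
      sumFrom σ es (λ g → HW₀ (map g es) * G (set g e false)) + 0ℤ
    ≡⟨ ℤP.+-identityʳ _ ⟩
      sumFrom σ es (λ g → HW₀ (map g es) * G (set g e false))
    ≡⟨ sumFrom-HW₀ σ es (λ g → G (set g e false)) uniq' (set-ext e false ext) ⟩
      G (set (clear es σ) e false)
    ≡⟨ ext cleared ⟩
      G (clear (e ∷ es) σ)
    ∎
    where
    open ≡-Reasoning
    map-set : ∀ g x → map (set g e x) (e ∷ es) ≡ x ∷ map g es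
    map-set g x = cong₂ _∷_ (set-≡ g e x) (map-set-∉ g x es (head∉tail uniq))
    cleared : set (clear es σ) e false ≗ clear (e ∷ es) σ
    cleared e' with e' ≟ e
    ... | yes refl = refl
    ... | no _     = refl

  sumFrom-HW₌₁ : ∀ σ es G → Unique es → Extensional G →
                 sumFrom σ es (λ g → HW₌₁ (map g es) * G g) ≡ sumℤ (map (λ e → G (single es σ e)) es)
  sumFrom-HW₌₁ σ []       G _ ext = refl
  sumFrom-HW₌₁ σ (e ∷ es) G uniq@(_ ∷ uniq') ext = begin
      sumFrom σ es (λ g → HW₌₁ (map (set g e false) (e ∷ es)) * G (set g e false))
    + sumFrom σ es (λ g → HW₌₁ (map (set g e true) (e ∷ es)) * G (set g e true))
    ≡⟨ cong₂ _+_ (sumFrom-cong σ es λ g _ → cong (λ z → HW₌₁ z * G (set g e false)) (map-set g false))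
                 (sumFrom-cong σ es λ g _ → cong (λ z → HW₌₁ z * G (set g e true)) (map-set g true)) ⟩
      sumFrom σ es (λ g → HW₌₁ (map g es) * G (set g e false))
    + sumFrom σ es (λ g → HW₀ (map g es) * G (set g e true))
    ≡⟨ cong₂ _+_ (sumFrom-HW₌₁ σ es (λ g → G (set g e false)) uniq' (set-ext e false ext))
                 (sumFrom-HW₀ σ es (λ g → G (set g e true)) uniq' (set-ext e true ext)) ⟩
      sumℤ (map (λ e' → G (set (single es σ e') e false)) es) + G (set (clear es σ) e true)
    ≡⟨ cong₂ _+_ (cong sumℤ (Listₚ.map-cong-local (All.tabulate λ e'∈es → ext (others e'∈es))))
                 (ext chosen) ⟩
      sumℤ (map (λ e' → G (single (e ∷ es) σ e')) es) + G (single (e ∷ es) σ e)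
    ≡⟨ ℤP.+-comm (sumℤ (map (λ e' → G (single (e ∷ es) σ e')) es)) (G (single (e ∷ es) σ e)) ⟩
      G (single (e ∷ es) σ e) + sumℤ (map (λ e' → G (single (e ∷ es) σ e')) es)
    ∎
    where
    open ≡-Reasoning
    map-set : ∀ g x → map (set g e x) (e ∷ es) ≡ x ∷ map g es
    map-set g x = cong₂ _∷_ (set-≡ g e x) (map-set-∉ g x es (head∉tail uniq))
    chosen : set (clear es σ) e true ≗ single (e ∷ es) σ e
    chosen e' with e' ≟ e
    ... | yes refl = refl
    ... | no _     = refl
    others : ∀ {e'} → e' ∈ es → set (single es σ e') e false ≗ single (e ∷ es) σ e'
    others {e'} e'∈es e'' with e'' ≟ e
    ... | yes refl = sym (dec-false (e ≟ e') λ { refl → head∉tail uniq e'∈es })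
    ... | no _     = refl

cell : Bool → Bool → Bool → Bool → Bool → Bool → Bool → ℤ
cell true  N E S W e₁ e₂ = PRE (N ∷ E ∷ S ∷ W ∷ e₁ ∷ e₂ ∷ [])
cell false N E S W _  _  = PASS (N ∷ E ∷ S ∷ W ∷ [])

BoolPred : ℕ → Set
BoolPred zero    = Bool
BoolPred (suc k) = Bool → BoolPred k

Everywhere : ∀ k → BoolPred k → Set
Everywhere zero    v = T v
Everywhere (suc k) p = ∀ x → Everywhere k (p x)

everywhere? : ∀ k → BoolPred k → Bool
everywhere? zero    v = v
everywhere? (suc k) p = everywhere? k (p false) ∧ everywhere? k (p true)

everywhere?-sound : ∀ k p → T (everywhere? k p) → Everywhere k p
everywhere?-sound zero    v h       = h
everywhere?-sound (suc k) p h false = everywhere?-sound k (p false) (proj₁ (Equivalence.to T-∧ h))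
everywhere?-sound (suc k) p h true  = everywhere?-sound k (p true)  (proj₂ (Equivalence.to T-∧ h))

cell-rule : BoolPred 7
cell-rule c N E S W e₁ e₂ = does (cell c N E S W e₁ e₂ ℤ.≟ 0ℤ)
  ∨ (does (S Bool.≟ (c ∧ e₁) xor ((c ∧ e₂) xor N)) ∧ does (E Bool.≟ W))

cell-rule-holds : Everywhere 7 cell-rule
cell-rule-holds = everywhere?-sound 7 cell-rule tt

cell-nonzero : ∀ c N E S W e₁ e₂ → cell c N E S W e₁ e₂ ≢ 0ℤ →
               S ≡ (c ∧ e₁) xor ((c ∧ e₂) xor N) × E ≡ W
cell-nonzero c N E S W e₁ e₂ ≢0
  with cell c N E S W e₁ e₂ ℤ.≟ 0ℤ | S Bool.≟ (c ∧ e₁) xor ((c ∧ e₂) xor N) | E Bool.≟ W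
     | cell-rule-holds c N E S W e₁ e₂
... | yes ≡0 | _      | _      | _ = ⊥-elim (≢0 ≡0)
... | no _   | yes S≡ | yes E≡ | _ = S≡ , E≡
... | no _   | no _   | _      | ()
... | no _   | yes _  | no _   | ()

cell-mask : ∀ c N E S W e₁ e₂ → cell c N E S W e₁ e₂ ≡ cell c N E S W (c ∧ e₁) (c ∧ e₂)
cell-mask true  N E S W e₁ e₂ = refl
cell-mask false N E S W e₁ e₂ = refl

flag : ∀ {m} → (Fin m → Bool) → Maybe (Fin m) → ℕ → Bool
flag c nothing  k = false
flag c (just i) k = (toℕ i ℕ.≡ᵇ k) ∧ c i

shift : ∀ {m} → Maybe (Fin (suc m)) → Maybe (Fin m)
shift nothing             = nothing
shift (just Fin.zero)     = nothing
shift (just (Fin.suc i))  = just i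

flag-shift : ∀ {m} (c : Fin (suc m) → Bool) p k → flag c p (suc k) ≡ flag (c ∘ Fin.suc) (shift p) k
flag-shift c nothing            k = refl
flag-shift c (just Fin.zero)    k = refl
flag-shift c (just (Fin.suc i)) k = refl

-- The value forced on the vertical edge above row k: N, flipped at every apex edge.
vertical : ∀ {m} → (Fin m → Bool) → Bool → Maybe (Fin m) → Maybe (Fin m) → ℕ → Bool
vertical c N p₁ p₂ zero    = N
vertical c N p₁ p₂ (suc k) = flag c p₁ k xor (flag c p₂ k xor vertical c N p₁ p₂ k)

-- A column with apex cells c, horizontal values h and south boundary S; the weight is
-- that of the configuration with north boundary N and apex edges in rows p₁, p₂.
module Column {m : ℕ} (c h : Fin m → Bool) (S : Bool) where

  rowWeight : Bool → Maybe (Fin m) → Maybe (Fin m) → Fin m → ℤ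
  rowWeight N p₁ p₂ i = cell (c i) (v (toℕ i)) (h i) (if isLast i then S else v (suc (toℕ i))) (h i)
                             (flag c p₁ (toℕ i)) (flag c p₂ (toℕ i))
    where v = vertical c N p₁ p₂

  weight : Bool → Maybe (Fin m) → Maybe (Fin m) → ℤ
  weight N p₁ p₂ = ∏ (rowWeight N p₁ p₂)

  column : Bool → ℤst
  column N = tuple c (weight N)

-- Transfer through the top cell: its vertical edges agree (stay), or an apex edge at it
-- flips the vertical value (flipₛ, flipₜ), or both apex edges are at it.
step : Bool → Bool → (Bool → ℤst) → Bool → ℤst
step c₀ h₀ T N =
  ⟨ stay * c₁ (T N)
  , stay * cₛ (T N) + flipₛ * c₁ (T (not N))
  , stay * cₜ (T N) + flipₜ * c₁ (T (not N))
  , stay * cₛₜ (T N) + flipₛ * cₜ (T (not N)) + flipₜ * cₛ (T (not N)) + both * c₁ (T N) ⟩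
  where
  stay  = cell c₀ N h₀ N h₀ false false
  flipₛ = when c₀ (cell true N h₀ (not N) h₀ true false)
  flipₜ = when c₀ (cell true N h₀ (not N) h₀ false true)
  both  = when c₀ (cell true N h₀ N h₀ true true)

when-true : ∀ c (F : Bool → ℤ) → when c (F c) ≡ when c (F true)
when-true true  F = refl
when-true false F = refl

when-idem : ∀ c x → when c (when c x) ≡ when c x
when-idem true  x = refl
when-idem false x = refl

module ColumnStep {m : ℕ} (c h : Fin (suc (suc m)) → Bool) (S : Bool) where
  open Column c h S
  private module Below = Column (c ∘ Fin.suc) (h ∘ Fin.suc) S

  vertical-shift : ∀ N p₁ p₂ k →
                   vertical c N p₁ p₂ (suc k) ≡ vertical (c ∘ Fin.suc) (vertical c N p₁ p₂ 1) (shift p₁) (shift p₂) k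
  vertical-shift N p₁ p₂ zero    = refl
  vertical-shift N p₁ p₂ (suc k)
    rewrite vertical-shift N p₁ p₂ k | flag-shift c p₁ k | flag-shift c p₂ k = refl

  rowWeight-shift : ∀ N p₁ p₂ i →
                    rowWeight N p₁ p₂ (Fin.suc i) ≡ Below.rowWeight (vertical c N p₁ p₂ 1) (shift p₁) (shift p₂) i
  rowWeight-shift N p₁ p₂ i
    rewrite vertical-shift N p₁ p₂ (toℕ i) | flag-shift c p₁ (toℕ i) | flag-shift c p₂ (toℕ i) = refl

  weight-step : ∀ N p₁ p₂ →
                weight N p₁ p₂ ≡ rowWeight N p₁ p₂ Fin.zero * Below.weight (vertical c N p₁ p₂ 1) (shift p₁) (shift p₂)
  weight-step N p₁ p₂ = cong (rowWeight N p₁ p₂ Fin.zero *_) (∏-cong (rowWeight-shift N p₁ p₂))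

  column-step : ∀ N → column N ≡ step (c Fin.zero) (h Fin.zero) Below.column N
  column-step N = ⟨⟩-cong (weight-step N nothing nothing) cₛ-step cₜ-step cₛₜ-step
    where
    open ≡-Reasoning
    c₀ = c Fin.zero
    h₀ = h Fin.zero
    c' = c ∘ Fin.suc
    W = Below.weight
    stay  = cell c₀ N h₀ N h₀ false false
    flipₛ = when c₀ (cell true N h₀ (not N) h₀ true false)
    flipₜ = when c₀ (cell true N h₀ (not N) h₀ false true)
    both  = when c₀ (cell true N h₀ N h₀ true true)

    below : ∀ {F : Fin (suc m) → ℤ} G → (∀ i → F i ≡ stay * G i) → ∑⟨ c' ⟩ F ≡ stay * ∑⟨ c' ⟩ G
    below G F≡ = trans (∑-cong λ i → cong (when (c' i)) (F≡ i)) (∑⟨⟩-*ˡ c' stay G)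

    flipped : ∀ (e₁ e₂ : Bool → Bool) (V : Bool → ℤ) →
              when c₀ (cell c₀ N h₀ (c₀ xor N) h₀ (e₁ c₀) (e₂ c₀) * V (c₀ xor N))
              ≡ when c₀ (cell true N h₀ (not N) h₀ (e₁ true) (e₂ true)) * V (not N)
    flipped e₁ e₂ V =
      trans (when-true c₀ λ κ → cell κ N h₀ (κ xor N) h₀ (e₁ κ) (e₂ κ) * V (κ xor N))
            (when-*ʳ c₀ (cell true N h₀ (not N) h₀ (e₁ true) (e₂ true)) (V (not N)))

    cₛ-step : when c₀ (weight N (just Fin.zero) nothing) + ∑⟨ c' ⟩ (λ i → weight N (just (Fin.suc i)) nothing)
              ≡ stay * cₛ (Below.column N) + flipₛ * c₁ (Below.column (not N))
    cₛ-step = begin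
        when c₀ (weight N (just Fin.zero) nothing) + ∑⟨ c' ⟩ (λ i → weight N (just (Fin.suc i)) nothing)
      ≡⟨ cong₂ _+_ (trans (cong (when c₀) (weight-step N (just Fin.zero) nothing))
                          (flipped (λ κ → κ) (λ _ → false) λ v → W v nothing nothing))
                   (below (λ i → W N (just i) nothing) λ i → weight-step N (just (Fin.suc i)) nothing) ⟩
        flipₛ * c₁ (Below.column (not N)) + stay * cₛ (Below.column N)
      ≡⟨ ℤP.+-comm (flipₛ * c₁ (Below.column (not N))) (stay * cₛ (Below.column N)) ⟩
        stay * cₛ (Below.column N) + flipₛ * c₁ (Below.column (not N))
      ∎

    cₜ-step : when c₀ (weight N nothing (just Fin.zero)) + ∑⟨ c' ⟩ (λ i → weight N nothing (just (Fin.suc i)))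
              ≡ stay * cₜ (Below.column N) + flipₜ * c₁ (Below.column (not N))
    cₜ-step = begin
        when c₀ (weight N nothing (just Fin.zero)) + ∑⟨ c' ⟩ (λ i → weight N nothing (just (Fin.suc i)))
      ≡⟨ cong₂ _+_ (trans (cong (when c₀) (weight-step N nothing (just Fin.zero)))
                          (flipped (λ _ → false) (λ κ → κ) λ v → W v nothing nothing))
                   (below (λ i → W N nothing (just i)) λ i → weight-step N nothing (just (Fin.suc i))) ⟩
        flipₜ * c₁ (Below.column (not N)) + stay * cₜ (Below.column N)
      ≡⟨ ℤP.+-comm (flipₜ * c₁ (Below.column (not N))) (stay * cₜ (Below.column N)) ⟩
        stay * cₜ (Below.column N) + flipₜ * c₁ (Below.column (not N))
      ∎

    bothSet : when c₀ (when c₀ (weight N (just Fin.zero) (just Fin.zero))) ≡ both * c₁ (Below.column N)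
    bothSet = begin
        when c₀ (when c₀ (weight N (just Fin.zero) (just Fin.zero)))
      ≡⟨ trans (when-idem c₀ _) (cong (when c₀) (weight-step N (just Fin.zero) (just Fin.zero))) ⟩
        when c₀ (cell c₀ N h₀ (c₀ xor (c₀ xor N)) h₀ c₀ c₀ * W (c₀ xor (c₀ xor N)) nothing nothing)
      ≡⟨ when-true c₀ (λ κ → cell κ N h₀ (κ xor (κ xor N)) h₀ κ κ * W (κ xor (κ xor N)) nothing nothing) ⟩
        when c₀ (cell true N h₀ (not (not N)) h₀ true true * W (not (not N)) nothing nothing)
      ≡⟨ cong (λ v → when c₀ (cell true N h₀ v h₀ true true * W v nothing nothing)) (not-involutive N) ⟩
        when c₀ (cell true N h₀ N h₀ true true * W N nothing nothing)
      ≡⟨ when-*ʳ c₀ (cell true N h₀ N h₀ true true) (W N nothing nothing) ⟩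
        both * c₁ (Below.column N)
      ∎

    secondSet : when c₀ (∑⟨ c' ⟩ λ i₁ → weight N (just (Fin.suc i₁)) (just Fin.zero))
                ≡ flipₜ * cₛ (Below.column (not N))
    secondSet = begin
        when c₀ (∑⟨ c' ⟩ λ i₁ → weight N (just (Fin.suc i₁)) (just Fin.zero))
      ≡⟨ cong (when c₀) (∑-cong λ i₁ → cong (when (c' i₁)) (weight-step N (just (Fin.suc i₁)) (just Fin.zero))) ⟩
        when c₀ (∑⟨ c' ⟩ λ i₁ → cell c₀ N h₀ (c₀ xor N) h₀ false c₀ * W (c₀ xor N) (just i₁) nothing)
      ≡⟨ when-true c₀ (λ κ → ∑⟨ c' ⟩ λ i₁ → cell κ N h₀ (κ xor N) h₀ false κ * W (κ xor N) (just i₁) nothing) ⟩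
        when c₀ (∑⟨ c' ⟩ λ i₁ → cell true N h₀ (not N) h₀ false true * W (not N) (just i₁) nothing)
      ≡⟨ cong (when c₀) (∑⟨⟩-*ˡ c' (cell true N h₀ (not N) h₀ false true) λ i₁ → W (not N) (just i₁) nothing) ⟩
        when c₀ (cell true N h₀ (not N) h₀ false true * cₛ (Below.column (not N)))
      ≡⟨ when-*ʳ c₀ (cell true N h₀ (not N) h₀ false true) (cₛ (Below.column (not N))) ⟩
        flipₜ * cₛ (Below.column (not N))
      ∎

    firstSet : ∑⟨ c' ⟩ (λ i₂ → when c₀ (weight N (just Fin.zero) (just (Fin.suc i₂))))
               ≡ flipₛ * cₜ (Below.column (not N))
    firstSet = trans (∑-cong λ i₂ → cong (when (c' i₂))
                       (trans (cong (when c₀) (weight-step N (just Fin.zero) (just (Fin.suc i₂))))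
                              (flipped (λ κ → κ) (λ _ → false) λ v → W v nothing (just i₂))))
                     (∑⟨⟩-*ˡ c' flipₛ λ i₂ → W (not N) nothing (just i₂))

    neitherSet : ∑⟨ c' ⟩ (λ i₂ → ∑⟨ c' ⟩ λ i₁ → weight N (just (Fin.suc i₁)) (just (Fin.suc i₂)))
                 ≡ stay * cₛₜ (Below.column N)
    neitherSet = below (λ i₂ → ∑⟨ c' ⟩ λ i₁ → W N (just i₁) (just i₂))
                   λ i₂ → below (λ i₁ → W N (just i₁) (just i₂))
                             λ i₁ → weight-step N (just (Fin.suc i₁)) (just (Fin.suc i₂))

    cₛₜ-step : when c₀ (when c₀ (weight N (just Fin.zero) (just Fin.zero))
                        + ∑⟨ c' ⟩ λ i₁ → weight N (just (Fin.suc i₁)) (just Fin.zero))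
               + ∑⟨ c' ⟩ (λ i₂ → when c₀ (weight N (just Fin.zero) (just (Fin.suc i₂)))
                                 + ∑⟨ c' ⟩ λ i₁ → weight N (just (Fin.suc i₁)) (just (Fin.suc i₂)))
               ≡ stay * cₛₜ (Below.column N) + flipₛ * cₜ (Below.column (not N))
                 + flipₜ * cₛ (Below.column (not N)) + both * c₁ (Below.column N)
    cₛₜ-step = begin
        _
      ≡⟨ cong₂ _+_ (when-+ c₀ _ _)
                   (∑⟨⟩-+ c' (λ i₂ → when c₀ (weight N (just Fin.zero) (just (Fin.suc i₂))))
                             (λ i₂ → ∑⟨ c' ⟩ λ i₁ → weight N (just (Fin.suc i₁)) (just (Fin.suc i₂)))) ⟩
        _
      ≡⟨ cong₂ _+_ (cong₂ _+_ bothSet secondSet) (cong₂ _+_ firstSet neitherSet) ⟩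
        (both * c₁ (Below.column N) + flipₜ * cₛ (Below.column (not N)))
        + (flipₛ * cₜ (Below.column (not N)) + stay * cₛₜ (Below.column N))
      ≡⟨ reverse (both * c₁ (Below.column N)) (flipₜ * cₛ (Below.column (not N)))
                 (flipₛ * cₜ (Below.column (not N))) (stay * cₛₜ (Below.column N)) ⟩
        stay * cₛₜ (Below.column N) + flipₛ * cₜ (Below.column (not N))
        + flipₜ * cₛ (Below.column (not N)) + both * c₁ (Below.column N)
      ∎
      where
      reverse : ∀ a b c d → (a + b) + (c + d) ≡ d + c + b + a
      reverse = solve-∀

count : ∀ {m} → (Fin m → Bool) → ℕ
count {zero}  f = 0
count {suc m} f = (if f Fin.zero then 1 else 0) ℕ.+ count (f ∘ Fin.suc)

count-false : ∀ m → count {m} (λ _ → false) ≡ 0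
count-false zero    = refl
count-false (suc m) = count-false m

hw-map-tabulate : ∀ {m} {X : Set} (f : X → Bool) (g : Fin m → X) → hw (map f (tabulate g)) ≡ count (f ∘ g)
hw-map-tabulate {zero}  f g = refl
hw-map-tabulate {suc m} f g with f (g Fin.zero)
... | true  = cong suc (hw-map-tabulate f (g ∘ Fin.suc))
... | false = hw-map-tabulate f (g ∘ Fin.suc)

hwF≡count : ∀ {m} (s : Fin m → Bool) → hwF s ≡ count s
hwF≡count s = hw-map-tabulate s (λ i → i)

count-head : ∀ {m} (s : Fin (suc m) → Bool) {c} → s Fin.zero ≡ c → count s ≡ (if c then 1 else 0) ℕ.+ count (s ∘ Fin.suc)
count-head s refl = refl

count≡0 : ∀ {m} (s : Fin m → Bool) → count s ≡ 0 → ∀ i → s i ≡ false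
count≡0 {suc m} s count≡ i with s Fin.zero in s₀
... | true  with () ← count≡
... | false with i
...   | Fin.zero   = s₀
...   | Fin.suc i' = count≡0 (s ∘ Fin.suc) count≡ i'

count≡1 : ∀ {m} (s : Fin m → Bool) → count s ≡ 1 → ∃ λ v → s isIdx v
count≡1 {suc m} s count≡ with s Fin.zero in s₀
... | true  = Fin.zero , λ where
  Fin.zero    → s₀
  (Fin.suc i) → count≡0 (s ∘ Fin.suc) (ℕP.suc-injective count≡) i
... | false with count≡1 (s ∘ Fin.suc) count≡
...   | v , s'≡v = Fin.suc v , λ where
  Fin.zero    → s₀
  (Fin.suc i) → s'≡v i

isIdx⇒count≡1 : ∀ {m} (s : Fin m → Bool) {v} → s isIdx v → count s ≡ 1
isIdx⇒count≡1 {suc m} s {Fin.zero}  s≡v = trans (count-head s (s≡v Fin.zero)) (cong suc (allFalse (s ∘ Fin.suc) (s≡v ∘ Fin.suc)))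
  where
  allFalse : ∀ {k} (f : Fin k → Bool) → (∀ i → f i ≡ false) → count f ≡ 0
  allFalse {zero}  f _ = refl
  allFalse {suc k} f f≡ = trans (count-head f (f≡ Fin.zero)) (allFalse (f ∘ Fin.suc) (f≡ ∘ Fin.suc))
isIdx⇒count≡1 {suc m} s {Fin.suc v} s≡v = trans (count-head s (s≡v Fin.zero)) (isIdx⇒count≡1 (s ∘ Fin.suc) (s≡v ∘ Fin.suc))

search : ∀ {m} (f : Fin m → Bool) → (∃ λ i → f i ≡ true) ⊎ (∀ i → f i ≡ false)
search f with any? (λ i → f i Bool.≟ true)
... | yes found = inj₁ found
... | no  none  = inj₂ λ i → ¬-not λ fi≡true → none (i , fi≡true)

suc-C-2 : ∀ k → suc k C 2 ≡ k C 2 ℕ.+ k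
suc-C-2 k = begin
    suc k C 2         ≡⟨ nCk+nC[k+1]≡[n+1]C[k+1] k 1 ⟨
    k C 1 ℕ.+ k C 2   ≡⟨ cong (ℕ._+ k C 2) (nC1≡n k) ⟩
    k ℕ.+ k C 2       ≡⟨ ℕP.+-comm k (k C 2) ⟩
    k C 2 ℕ.+ k       ∎
  where open ≡-Reasoning

-- Column polynomials as functions of the north and south boundary values: a column
-- without horizontal signal, with K apex cells and K₂ = K choose 2, ...
quiet : ℤ → ℤ → Bool → Bool → ℤst
quiet K K₂ false false = ⟨ 1ℤ , 0ℤ , 0ℤ , K₂ ⟩
quiet K K₂ false true  = ⟨ 0ℤ , K , 0ℤ , 0ℤ ⟩
quiet K K₂ true  false = ⟨ 0ℤ , 0ℤ , K , 0ℤ ⟩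
quiet K K₂ true  true  = ⟨ 1ℤ , 0ℤ , 0ℤ , K + K₂ ⟩

-- ... and a column crossed by the signal in a row that is (U = 1) or is not (U = 0) an
-- apex cell, with A (B) apex cells above (below) it, A₂ = A choose 2, B₂ = B choose 2.
crossed : ℤ → ℤ → ℤ → ℤ → ℤ → Bool → Bool → ℤst
crossed A U B A₂ B₂ false false = ⟨ 1ℤ , 0ℤ , 0ℤ , A₂ + B₂ + U * (A + B) - A * B ⟩
crossed A U B A₂ B₂ false true  = ⟨ 0ℤ , B + U - A , 0ℤ , 0ℤ ⟩
crossed A U B A₂ B₂ true  false = ⟨ 0ℤ , 0ℤ , A + U - B , 0ℤ ⟩
crossed A U B A₂ B₂ true  true  = ⟨ - 1ℤ , 0ℤ , 0ℤ , A * B + U * (A + B) + U - (A + B) - A₂ - B₂ ⟩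

step-cong : ∀ c₀ h₀ {T T'} → (∀ N → T N ≡ T' N) → ∀ N → step c₀ h₀ T N ≡ step c₀ h₀ T' N
step-cong c₀ h₀ T≡T' N rewrite T≡T' N | T≡T' (not N) = refl

QuietStep EntryStep AboveStep : Bool → Bool → Bool → Set
QuietStep c₀ N S = ∀ K K₂ →
  step c₀ false (λ N' → quiet K K₂ N' S) N ≡ quiet (when c₀ 1ℤ + K) (K₂ + when c₀ K) N S
EntryStep c₀ N S = ∀ K K₂ →
  step c₀ true (λ N' → quiet K K₂ N' S) N ≡ crossed 0ℤ (when c₀ 1ℤ) K 0ℤ K₂ N S
AboveStep c₀ N S = ∀ A U B A₂ B₂ →
  step c₀ false (λ N' → crossed A U B A₂ B₂ N' S) N ≡ crossed (when c₀ 1ℤ + A) U B (A₂ + when c₀ A) B₂ N S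

quiet-ttt : QuietStep true true true
quiet-ttt K K₂ = ⟨⟩-cong refl refl refl (ring K K₂)
  where
  ring : ∀ K K₂ → 1ℤ * (K + K₂) + 0ℤ * 0ℤ + 1ℤ * K + 1ℤ * 1ℤ ≡ (1ℤ + K) + (K₂ + K)
  ring = solve-∀

quiet-ttf : QuietStep true true false
quiet-ttf K K₂ = ⟨⟩-cong refl refl (ring K) refl
  where
  ring : ∀ K → 1ℤ * K + 1ℤ * 1ℤ ≡ 1ℤ + K
  ring = solve-∀

quiet-tft : QuietStep true false true
quiet-tft K K₂ = ⟨⟩-cong refl (ring K) refl refl
  where
  ring : ∀ K → 1ℤ * K + 1ℤ * 1ℤ ≡ 1ℤ + K
  ring = solve-∀

quiet-tff : QuietStep true false false
quiet-tff K K₂ = ⟨⟩-cong refl refl refl (ring K K₂)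
  where
  ring : ∀ K K₂ → 1ℤ * K₂ + 1ℤ * K + 0ℤ * 0ℤ + 0ℤ * 1ℤ ≡ K₂ + K
  ring = solve-∀

quiet-ftt : QuietStep false true true
quiet-ftt K K₂ = ⟨⟩-cong refl refl refl (ring K K₂)
  where
  ring : ∀ K K₂ → 1ℤ * (K + K₂) + 0ℤ * 0ℤ + 0ℤ * K + 0ℤ * 1ℤ ≡ (0ℤ + K) + (K₂ + 0ℤ)
  ring = solve-∀

quiet-ftf : QuietStep false true false
quiet-ftf K K₂ = ⟨⟩-cong refl refl (ring K) refl
  where
  ring : ∀ K → 1ℤ * K + 0ℤ * 1ℤ ≡ 0ℤ + K
  ring = solve-∀

quiet-fft : QuietStep false false true
quiet-fft K K₂ = ⟨⟩-cong refl (ring K) refl refl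
  where
  ring : ∀ K → 1ℤ * K + 0ℤ * 1ℤ ≡ 0ℤ + K
  ring = solve-∀

quiet-fff : QuietStep false false false
quiet-fff K K₂ = ⟨⟩-cong refl refl refl (ring K K₂)
  where
  ring : ∀ K K₂ → 1ℤ * K₂ + 0ℤ * K + 0ℤ * 0ℤ + 0ℤ * 1ℤ ≡ K₂ + 0ℤ
  ring = solve-∀

step-quiet : ∀ c₀ N S → QuietStep c₀ N S
step-quiet true  true  true  = quiet-ttt
step-quiet true  true  false = quiet-ttf
step-quiet true  false true  = quiet-tft
step-quiet true  false false = quiet-tff
step-quiet false true  true  = quiet-ftt
step-quiet false true  false = quiet-ftf
step-quiet false false true  = quiet-fft
step-quiet false false false = quiet-fff

entry-ttt : EntryStep true true true
entry-ttt K K₂ = ⟨⟩-cong refl refl refl (ring K K₂)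
  where
  ring : ∀ K K₂ → (- 1ℤ) * (K + K₂) + 0ℤ * 0ℤ + 1ℤ * K + 1ℤ * 1ℤ ≡ 0ℤ * K + 1ℤ * (0ℤ + K) + 1ℤ - (0ℤ + K) - 0ℤ - K₂
  ring = solve-∀

entry-ttf : EntryStep true true false
entry-ttf K K₂ = ⟨⟩-cong refl refl (ring K) refl
  where
  ring : ∀ K → (- 1ℤ) * K + 1ℤ * 1ℤ ≡ 0ℤ + 1ℤ - K
  ring = solve-∀

entry-tft : EntryStep true false true
entry-tft K K₂ = ⟨⟩-cong refl (ring K) refl refl
  where
  ring : ∀ K → 1ℤ * K + 1ℤ * 1ℤ ≡ K + 1ℤ - 0ℤ
  ring = solve-∀

entry-tff : EntryStep true false false
entry-tff K K₂ = ⟨⟩-cong refl refl refl (ring K K₂)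
  where
  ring : ∀ K K₂ → 1ℤ * K₂ + 1ℤ * K + 0ℤ * 0ℤ + 0ℤ * 1ℤ ≡ 0ℤ + K₂ + 1ℤ * (0ℤ + K) - 0ℤ * K
  ring = solve-∀

entry-ftt : EntryStep false true true
entry-ftt K K₂ = ⟨⟩-cong refl refl refl (ring K K₂)
  where
  ring : ∀ K K₂ → (- 1ℤ) * (K + K₂) + 0ℤ * 0ℤ + 0ℤ * K + 0ℤ * 1ℤ ≡ 0ℤ * K + 0ℤ * (0ℤ + K) + 0ℤ - (0ℤ + K) - 0ℤ - K₂
  ring = solve-∀

entry-ftf : EntryStep false true false
entry-ftf K K₂ = ⟨⟩-cong refl refl (ring K) refl
  where
  ring : ∀ K → (- 1ℤ) * K + 0ℤ * 1ℤ ≡ 0ℤ + 0ℤ - K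
  ring = solve-∀

entry-fft : EntryStep false false true
entry-fft K K₂ = ⟨⟩-cong refl (ring K) refl refl
  where
  ring : ∀ K → 1ℤ * K + 0ℤ * 1ℤ ≡ K + 0ℤ - 0ℤ
  ring = solve-∀

entry-fff : EntryStep false false false
entry-fff K K₂ = ⟨⟩-cong refl refl refl (ring K K₂)
  where
  ring : ∀ K K₂ → 1ℤ * K₂ + 0ℤ * K + 0ℤ * 0ℤ + 0ℤ * 1ℤ ≡ 0ℤ + K₂ + 0ℤ * (0ℤ + K) - 0ℤ * K
  ring = solve-∀

step-entry : ∀ c₀ N S → EntryStep c₀ N S
step-entry true  true  true  = entry-ttt
step-entry true  true  false = entry-ttf
step-entry true  false true  = entry-tft
step-entry true  false false = entry-tff
step-entry false true  true  = entry-ftt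
step-entry false true  false = entry-ftf
step-entry false false true  = entry-fft
step-entry false false false = entry-fff

above-ttt : AboveStep true true true
above-ttt A U B A₂ B₂ = ⟨⟩-cong refl refl refl (ring A U B A₂ B₂)
  where
  ring : ∀ A U B A₂ B₂ → 1ℤ * (A * B + U * (A + B) + U - (A + B) - A₂ - B₂) + 0ℤ * 0ℤ + 1ℤ * (B + U - A) + 1ℤ * (- 1ℤ) ≡ (1ℤ + A) * B + U * ((1ℤ + A) + B) + U - ((1ℤ + A) + B) - (A₂ + A) - B₂
  ring = solve-∀

above-ttf : AboveStep true true false
above-ttf A U B A₂ B₂ = ⟨⟩-cong refl refl (ring A U B) refl
  where
  ring : ∀ A U B → 1ℤ * (A + U - B) + 1ℤ * 1ℤ ≡ (1ℤ + A) + U - B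
  ring = solve-∀

above-tft : AboveStep true false true
above-tft A U B A₂ B₂ = ⟨⟩-cong refl (ring A U B) refl refl
  where
  ring : ∀ A U B → 1ℤ * (B + U - A) + 1ℤ * (- 1ℤ) ≡ B + U - (1ℤ + A)
  ring = solve-∀

above-tff : AboveStep true false false
above-tff A U B A₂ B₂ = ⟨⟩-cong refl refl refl (ring A U B A₂ B₂)
  where
  ring : ∀ A U B A₂ B₂ → 1ℤ * (A₂ + B₂ + U * (A + B) - A * B) + 1ℤ * (A + U - B) + 0ℤ * 0ℤ + 0ℤ * 1ℤ ≡ (A₂ + A) + B₂ + U * ((1ℤ + A) + B) - (1ℤ + A) * B
  ring = solve-∀

above-ftt : AboveStep false true true
above-ftt A U B A₂ B₂ = ⟨⟩-cong refl refl refl (ring A U B A₂ B₂)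
  where
  ring : ∀ A U B A₂ B₂ → 1ℤ * (A * B + U * (A + B) + U - (A + B) - A₂ - B₂) + 0ℤ * 0ℤ + 0ℤ * (B + U - A) + 0ℤ * (- 1ℤ) ≡ (0ℤ + A) * B + U * ((0ℤ + A) + B) + U - ((0ℤ + A) + B) - (A₂ + 0ℤ) - B₂
  ring = solve-∀

above-ftf : AboveStep false true false
above-ftf A U B A₂ B₂ = ⟨⟩-cong refl refl (ring A U B) refl
  where
  ring : ∀ A U B → 1ℤ * (A + U - B) + 0ℤ * 1ℤ ≡ (0ℤ + A) + U - B
  ring = solve-∀

above-fft : AboveStep false false true
above-fft A U B A₂ B₂ = ⟨⟩-cong refl (ring A U B) refl refl
  where
  ring : ∀ A U B → 1ℤ * (B + U - A) + 0ℤ * (- 1ℤ) ≡ B + U - (0ℤ + A)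
  ring = solve-∀

above-fff : AboveStep false false false
above-fff A U B A₂ B₂ = ⟨⟩-cong refl refl refl (ring A U B A₂ B₂)
  where
  ring : ∀ A U B A₂ B₂ → 1ℤ * (A₂ + B₂ + U * (A + B) - A * B) + 0ℤ * (A + U - B) + 0ℤ * 0ℤ + 0ℤ * 1ℤ ≡ (A₂ + 0ℤ) + B₂ + U * ((0ℤ + A) + B) - (0ℤ + A) * B
  ring = solve-∀

step-above : ∀ c₀ N S → AboveStep c₀ N S
step-above true  true  true  = above-ttt
step-above true  true  false = above-ttf
step-above true  false true  = above-tft
step-above true  false false = above-tff
step-above false true  true  = above-ftt
step-above false true  false = above-ftf
step-above false false true  = above-fft
step-above false false false = above-fff

count-step : ∀ c a → when c 1ℤ + + a ≡ + ((if c then 1 else 0) ℕ.+ a)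
count-step true  a = refl
count-step false a = refl

C-2-step : ∀ c a → + (a C 2) + when c (+ a) ≡ + (((if c then 1 else 0) ℕ.+ a) C 2)
C-2-step true  a = cong +_ (sym (suc-C-2 a))
C-2-step false a = ℤP.+-identityʳ (+ (a C 2))

countAbove countBelow : ∀ {m} → (Fin m → Bool) → Fin m → ℕ
countAbove c u = count λ i → (toℕ i <ᵇ toℕ u) ∧ c i
countBelow c u = count λ i → (toℕ u <ᵇ toℕ i) ∧ c i

column-quiet : ∀ m (c : Fin (suc m) → Bool) S N →
               Column.column c (λ _ → false) S N ≡ quiet (+ count c) (+ (count c C 2)) N S
column-quiet zero c S N with c Fin.zero | S | N
... | true  | true  | true  = refl
... | true  | true  | false = refl
... | true  | false | true  = refl
... | true  | false | false = refl
... | false | true  | true  = refl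
... | false | true  | false = refl
... | false | false | true  = refl
... | false | false | false = refl
column-quiet (suc m) c S N = begin
    Column.column c (λ _ → false) S N
  ≡⟨ ColumnStep.column-step c (λ _ → false) S N ⟩
    step c₀ false (Column.column (c ∘ Fin.suc) (λ _ → false) S) N
  ≡⟨ step-cong c₀ false (column-quiet m (c ∘ Fin.suc) S) N ⟩
    step c₀ false (λ N' → quiet (+ k) (+ (k C 2)) N' S) N
  ≡⟨ step-quiet c₀ N S (+ k) (+ (k C 2)) ⟩
    quiet (when c₀ 1ℤ + + k) (+ (k C 2) + when c₀ (+ k)) N S
  ≡⟨ cong₂ (λ K K₂ → quiet K K₂ N S) (count-step c₀ k) (C-2-step c₀ k) ⟩
    quiet (+ count c) (+ (count c C 2)) N S
  ∎
  where
  open ≡-Reasoning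
  c₀ = c Fin.zero
  k = count (c ∘ Fin.suc)

column-crossed : ∀ m (c : Fin (suc m) → Bool) u S N →
                 Column.column c (λ i → does (i Fin.≟ u)) S N
                 ≡ crossed (+ countAbove c u) (when (c u) 1ℤ) (+ countBelow c u)
                           (+ (countAbove c u C 2)) (+ (countBelow c u C 2)) N S
column-crossed zero c Fin.zero S N with c Fin.zero | S | N
... | true  | true  | true  = refl
... | true  | true  | false = refl
... | true  | false | true  = refl
... | true  | false | false = refl
... | false | true  | true  = refl
... | false | true  | false = refl
... | false | false | true  = refl
... | false | false | false = refl
column-crossed (suc m) c Fin.zero S N = begin
    Column.column c (λ i → does (i Fin.≟ Fin.zero)) S N
  ≡⟨ ColumnStep.column-step c (λ i → does (i Fin.≟ Fin.zero)) S N ⟩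
    step c₀ true (Column.column (c ∘ Fin.suc) (λ _ → false) S) N
  ≡⟨ step-cong c₀ true (column-quiet m (c ∘ Fin.suc) S) N ⟩
    step c₀ true (λ N' → quiet (+ k) (+ (k C 2)) N' S) N
  ≡⟨ step-entry c₀ N S (+ k) (+ (k C 2)) ⟩
    crossed 0ℤ (when c₀ 1ℤ) (+ k) 0ℤ (+ (k C 2)) N S
  ≡⟨ cong (λ a → crossed (+ a) (when c₀ 1ℤ) (+ k) (+ (a C 2)) (+ (k C 2)) N S) (sym (count-false (suc (suc m)))) ⟩
    crossed (+ countAbove c Fin.zero) (when c₀ 1ℤ) (+ countBelow c Fin.zero)
            (+ (countAbove c Fin.zero C 2)) (+ (countBelow c Fin.zero C 2)) N S
  ∎
  where
  open ≡-Reasoning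
  c₀ = c Fin.zero
  k = count (c ∘ Fin.suc)
column-crossed (suc m) c (Fin.suc u) S N = begin
    Column.column c (λ i → does (i Fin.≟ Fin.suc u)) S N
  ≡⟨ ColumnStep.column-step c (λ i → does (i Fin.≟ Fin.suc u)) S N ⟩
    step c₀ false (Column.column (c ∘ Fin.suc) (λ i → does (i Fin.≟ u)) S) N
  ≡⟨ step-cong c₀ false (column-crossed m (c ∘ Fin.suc) u S) N ⟩
    step c₀ false (λ N' → crossed (+ α′) U (+ β′) (+ (α′ C 2)) (+ (β′ C 2)) N' S) N
  ≡⟨ step-above c₀ N S (+ α′) U (+ β′) (+ (α′ C 2)) (+ (β′ C 2)) ⟩
    crossed (when c₀ 1ℤ + + α′) U (+ β′) (+ (α′ C 2) + when c₀ (+ α′)) (+ (β′ C 2)) N S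
  ≡⟨ cong₂ (λ A A₂ → crossed A U (+ β′) A₂ (+ (β′ C 2)) N S) (count-step c₀ α′) (C-2-step c₀ α′) ⟩
    crossed (+ countAbove c (Fin.suc u)) U (+ countBelow c (Fin.suc u))
            (+ (countAbove c (Fin.suc u) C 2)) (+ (countBelow c (Fin.suc u) C 2)) N S
  ∎
  where
  open ≡-Reasoning
  c₀ = c Fin.zero
  U = when (c (Fin.suc u)) 1ℤ
  α′ = countAbove (c ∘ Fin.suc) u
  β′ = countBelow (c ∘ Fin.suc) u

module ListFold (M : Monoid 0ℓ 0ℓ) where
  open Monoid M using (Carrier; _∙_; ε; _≈_; reflexive; ∙-congˡ; ∙-cong; identityˡ; assoc)
    renaming (refl to ≈-refl; sym to ≈-sym; trans to ≈-trans)
  open import Algebra.Properties.Monoid.Sum M using (sum)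

  fold : List Carrier → Carrier
  fold = foldr _∙_ ε

  fold-map-++ : ∀ {A : Set} (f : A → Carrier) xs ys → fold (map f (xs ++ ys)) ≈ fold (map f xs) ∙ fold (map f ys)
  fold-map-++ f []       ys = ≈-sym (identityˡ _)
  fold-map-++ f (x ∷ xs) ys = ≈-trans (∙-congˡ (fold-map-++ f xs ys)) (≈-sym (assoc (f x) _ _))

  fold-map-tabulate : ∀ {A : Set} {m} (f : A → Carrier) (g : Fin m → A) → fold (map f (tabulate g)) ≈ sum (f ∘ g)
  fold-map-tabulate {m = zero}  f g = ≈-refl
  fold-map-tabulate {m = suc m} f g = ∙-congˡ (fold-map-tabulate f (g ∘ Fin.suc))

  fold-map-cartesianProduct : ∀ {A B : Set} (f : A × B → Carrier) xs ys →
    fold (map f (cartesianProduct xs ys)) ≈ fold (map (λ a → fold (map (λ b → f (a , b)) ys)) xs)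
  fold-map-cartesianProduct f []       ys = ≈-refl
  fold-map-cartesianProduct f (a ∷ xs) ys =
    ≈-trans (fold-map-++ f (map (a ,_) ys) (cartesianProduct xs ys))
            (∙-cong (reflexive (cong fold (sym (Listₚ.map-∘ ys)))) (fold-map-cartesianProduct f xs ys))

module ∑List = ListFold ℤP.+-0-monoid
module ∏List = ListFold ℤP.*-1-monoid

sumℤ-filter : ∀ {A : Set} (f : A → ℤ) p l → sumℤ (map f (filterᵇ p l)) ≡ sumℤ (map (λ a → when (p a) (f a)) l)
sumℤ-filter f p []      = refl
sumℤ-filter f p (a ∷ l) with p a
... | true  = cong (λ z → f a + z) (sumℤ-filter f p l)
... | false = trans (sumℤ-filter f p l) (sym (ℤP.+-identityˡ _))

toℕ-≡ᵇ : ∀ {m} (i i' : Fin m) → (toℕ i ℕ.≡ᵇ toℕ i') ≡ does (i Fin.≟ i')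
toℕ-≡ᵇ Fin.zero    Fin.zero     = refl
toℕ-≡ᵇ Fin.zero    (Fin.suc i') = refl
toℕ-≡ᵇ (Fin.suc i) Fin.zero     = refl
toℕ-≡ᵇ (Fin.suc i) (Fin.suc i') = toℕ-≡ᵇ i i'

prodℤ-zero : ∀ {A : Set} (f : A → ℤ) {a l} → a ∈ l → f a ≡ 0ℤ → prodℤ (map f l) ≡ 0ℤ
prodℤ-zero f {l = a ∷ l} (here refl) fa≡0 = cong (_* prodℤ (map f l)) fa≡0
prodℤ-zero f {l = a' ∷ l} (there a∈l) fa≡0 = trans (cong (f a' *_) (prodℤ-zero f a∈l fa≡0)) (ℤP.*-zeroʳ (f a'))

module GridSum (n : ℕ) (A : Fin n → Fin n → Bool) (x : GDang n → Bool) where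
  open Grid n A
  open Assignments (_≟GE_ {n})
  open import Data.List.Membership.DecPropositional (_≟GE_ {n}) using (_∈?_)

  Cell : Set
  Cell = Fin n × Fin n

  edgesOf : Kind → (Cell → Bool) → List (GEdge n)
  edgesOf K p = map (K ,_) (filterᵇ p (cells n))

  V H P Q : List (GEdge n)
  V = edgesOf vert  (not ∘ isLast ∘ proj₁)
  H = edgesOf horiz (not ∘ isLast ∘ proj₂)
  P = edgesOf ap₁ inA
  Q = edgesOf ap₂ inA

  -- internalG lists the same edges through pattern lambdas, which agree with these only pointwise.
  internal≡ : internalG ≡ (V ++ H) ++ P ++ Q
  internal≡ = trans (cong₂ _++_ (edges-cong vert (λ _ → refl) (λ _ → refl))
                   (cong₂ _++_ (edges-cong horiz (λ _ → refl) (λ _ → refl))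
                   (cong₂ _++_ (edges-cong ap₁ (λ _ → refl) (λ _ → refl)) (edges-cong ap₂ (λ _ → refl) (λ _ → refl)))))
                    (sym (Listₚ.++-assoc V H (P ++ Q)))
    where
    edges-cong : ∀ K {f : Cell → GEdge n} {p q : Cell → Bool} → f ≗ (K ,_) → p ≗ q →
                 map f (filterᵇ p (cells n)) ≡ edgesOf K q
    edges-cong K {p = p} {q} f≗ p≗q =
      trans (Listₚ.map-cong f≗ _)
            (cong (map (K ,_)) (Listₚ.filter-≐ (T? ∘ p) (T? ∘ q)
                                  ((λ {c} → subst T (p≗q c)) , (λ {c} → subst T (sym (p≗q c)))) (cells n)))

  ∈cells : ∀ c → c ∈ cells n
  ∈cells (i , j) = ∈-cartesianProduct⁺ (∈-allFin i) (∈-allFin j)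

  ∈-edgesOf : ∀ K p {c} → p c ≡ true → (K , c) ∈ edgesOf K p
  ∈-edgesOf K p {c} pc = ∈-map⁺ (K ,_) (∈-filter⁺ (T? ∘ p) (∈cells c) (subst T (sym pc) _))

  ∈-edgesOf⁻ : ∀ {K K' p c} → (K' , c) ∈ edgesOf K p → K' ≡ K × p c ≡ true
  ∈-edgesOf⁻ {K} {p = p} e∈ with ∈-map⁻ (K ,_) e∈
  ... | _ , c∈ , refl = refl , Equivalence.to T-≡ (proj₂ (∈-filter⁻ (T? ∘ p) {xs = cells n} c∈))

  ∉-edgesOf : ∀ {K p c} → p c ≡ false → (K , c) ∉ edgesOf K p
  ∉-edgesOf pc≡false e∈ with () ← trans (sym pc≡false) (proj₂ (∈-edgesOf⁻ e∈))

  kind-∉ : ∀ {K K' p c} → K' ≢ K → (K' , c) ∉ edgesOf K p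
  kind-∉ K'≢K e∈ = K'≢K (proj₁ (∈-edgesOf⁻ e∈))

  ∉-++ : ∀ {e : GEdge n} {xs ys} → e ∉ xs → e ∉ ys → e ∉ xs ++ ys
  ∉-++ {xs = xs} e∉xs e∉ys e∈ = [ e∉xs , e∉ys ] (∈-++⁻ xs e∈)

  ap₁∉VH : ∀ c → (ap₁ , c) ∉ V ++ H
  ap₁∉VH c = ∉-++ (kind-∉ λ ()) (kind-∉ λ ())

  ap₂∉VH : ∀ c → (ap₂ , c) ∉ V ++ H
  ap₂∉VH c = ∉-++ (kind-∉ λ ()) (kind-∉ λ ())

  P∉VH : ∀ {e} → e ∈ P → e ∉ V ++ H
  P∉VH {_ , c} e∈ with ∈-edgesOf⁻ e∈
  ... | refl , _ = ap₁∉VH c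

  Q∉VH : ∀ {e} → e ∈ Q → e ∉ V ++ H
  Q∉VH {_ , c} e∈ with ∈-edgesOf⁻ e∈
  ... | refl , _ = ap₂∉VH c

  Q∉P : ∀ {e} → e ∈ Q → e ∉ P
  Q∉P {_ , c} e∈ with ∈-edgesOf⁻ e∈
  ... | refl , _ = kind-∉ λ ()

  unique-edgesOf : ∀ K p → Unique (edgesOf K p)
  unique-edgesOf K p = Uniqueₚ.map⁺ (cong proj₂)
    (Uniqueₚ.filter⁺ (T? ∘ p) (Uniqueₚ.cartesianProduct⁺ (Uniqueₚ.allFin⁺ n) (Uniqueₚ.allFin⁺ n)))

  unique-VH : Unique (V ++ H)
  unique-VH = Uniqueₚ.++⁺ (unique-edgesOf vert _) (unique-edgesOf horiz _) λ { (v∈V , v∈H) → disjoint v∈V v∈H }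
    where
    disjoint : ∀ {e} → e ∈ V → e ∉ H
    disjoint {_ , c} e∈ with ∈-edgesOf⁻ e∈
    ... | refl , _ = kind-∉ λ ()

  cellAt : (GEdge n → Bool) → Cell → ℤ
  cellAt g (i , j) = fG (b i j) (map [ x , g ] (incG (b i j)))

  cellProduct : (GEdge n → Bool) → ℤ
  cellProduct g = prodℤ (map (cellAt g) (cells n))

  integrand : (GEdge n → Bool) → ℤ
  integrand g = prodℤ (map (λ e → if g e then 1ℤ else 1ℤ) internalG)
              * prodℤ (map (λ v → fG v (map [ x , g ] (incG v))) vtxsG)

  integrand≡ : ∀ g → integrand g ≡ HW₌₁ (map g Q) * (HW₌₁ (map g P) * cellProduct g)
  integrand≡ g = begin
      integrand g
    ≡⟨ cong₂ _*_ (ones internalG) (∏List.fold-map-++ vertex (map (λ c → b (proj₁ c) (proj₂ c)) (cells n)) (a₁ ∷ a₂ ∷ [])) ⟩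
      1ℤ * (prodℤ (map vertex (map (λ c → b (proj₁ c) (proj₂ c)) (cells n))) * (vertex a₁ * (vertex a₂ * 1ℤ)))
    ≡⟨ cong (λ z → 1ℤ * (z * (vertex a₁ * (vertex a₂ * 1ℤ)))) (cong prodℤ (sym (Listₚ.map-∘ (cells n)))) ⟩
      1ℤ * (cellProduct g * (vertex a₁ * (vertex a₂ * 1ℤ)))
    ≡⟨ cong₂ (λ y z → 1ℤ * (cellProduct g * (HW₌₁ y * (HW₌₁ z * 1ℤ)))) (apexes ap₁) (apexes ap₂) ⟩
      1ℤ * (cellProduct g * (HW₌₁ (map g P) * (HW₌₁ (map g Q) * 1ℤ)))
    ≡⟨ regroup (cellProduct g) (HW₌₁ (map g P)) (HW₌₁ (map g Q)) ⟩
      HW₌₁ (map g Q) * (HW₌₁ (map g P) * cellProduct g)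
    ∎
    where
    open ≡-Reasoning
    vertex : GVtx n → ℤ
    vertex v = fG v (map [ x , g ] (incG v))
    ones : ∀ es → prodℤ (map (λ e → if g e then 1ℤ else 1ℤ) es) ≡ 1ℤ
    ones []       = refl
    ones (e ∷ es) with g e
    ... | true  = trans (ℤP.*-identityˡ _) (ones es)
    ... | false = trans (ℤP.*-identityˡ _) (ones es)
    apexes : ∀ K → map [ x , g ] (map (λ c → inj₂ (K , c)) (filterᵇ inA (cells n))) ≡ map g (edgesOf K inA)
    apexes K = trans (sym (Listₚ.map-∘ (filterᵇ inA (cells n)))) (Listₚ.map-∘ (filterᵇ inA (cells n)))
    regroup : ∀ c p q → 1ℤ * (c * (p * (q * 1ℤ))) ≡ q * (p * c)
    regroup = solve-∀

  σ₀ : Assignment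
  σ₀ _ = false

  cellProduct-ext : Extensional cellProduct
  cellProduct-ext g≗g' = cong prodℤ (Listₚ.map-cong (λ { (i , j) → cong (fG (b i j))
    (Listₚ.map-cong (λ { (inj₁ d) → refl ; (inj₂ e) → g≗g' e }) (incG (b i j))) }) (cells n))

  D : Assignment → ℤ
  D σ = sumFrom σ (V ++ H) cellProduct

  HW-P HW-Q : Assignment → ℤ
  HW-P g = HW₌₁ (map g P)
  HW-Q g = HW₌₁ (map g Q)

  map-agreeOff : ∀ {es g σ fs} → AgreeOff es g σ → (∀ {e} → e ∈ fs → e ∉ es) → map g fs ≡ map σ fs
  map-agreeOff g≈σ fs∉es = Listₚ.map-cong-local (All.tabulate λ e∈ → g≈σ _ (fs∉es e∈))

  sum-over-grid : ∀ σ → sumFrom σ (V ++ H) integrand ≡ HW-Q σ * (HW-P σ * D σ)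
  sum-over-grid σ = begin
      sumFrom σ (V ++ H) integrand
    ≡⟨ sumFrom-cong σ (V ++ H) (λ g _ → trans (integrand≡ g) (sym (ℤP.*-assoc (HW-Q g) (HW-P g) (cellProduct g)))) ⟩
      sumFrom σ (V ++ H) (λ g → HW-Q g * HW-P g * cellProduct g)
    ≡⟨ sumFrom-factorˡ σ (V ++ H) (λ g → HW-Q g * HW-P g) cellProduct (λ g g≈σ →
         cong₂ (λ y z → HW₌₁ y * HW₌₁ z) (map-agreeOff g≈σ Q∉VH) (map-agreeOff g≈σ P∉VH)) ⟩
      HW-Q σ * HW-P σ * D σ
    ≡⟨ ℤP.*-assoc (HW-Q σ) (HW-P σ) (D σ) ⟩
      HW-Q σ * (HW-P σ * D σ)
    ∎
    where open ≡-Reasoning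

  firstApex : Assignment → ℤ
  firstApex σ = sumℤ (map (λ e₁ → D (single P σ e₁)) P)

  sum-over-P : ∀ σ → sumFrom σ P (λ h → sumFrom h (V ++ H) integrand) ≡ HW-Q σ * firstApex σ
  sum-over-P σ = begin
      sumFrom σ P (λ h → sumFrom h (V ++ H) integrand)
    ≡⟨ sumFrom-cong σ P (λ h _ → sum-over-grid h) ⟩
      sumFrom σ P (λ h → HW-Q h * (HW-P h * D h))
    ≡⟨ sumFrom-factorˡ σ P HW-Q (λ h → HW-P h * D h) (λ h h≈σ → cong HW₌₁ (map-agreeOff h≈σ Q∉P)) ⟩
      HW-Q σ * sumFrom σ P (λ h → HW-P h * D h)
    ≡⟨ cong (HW-Q σ *_) (sumFrom-HW₌₁ σ P D (unique-edgesOf ap₁ inA) (sumFrom-ext (V ++ H) cellProduct-ext)) ⟩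
      HW-Q σ * firstApex σ
    ∎
    where open ≡-Reasoning

  firstApex-ext : Extensional firstApex
  firstApex-ext σ≗σ' = cong sumℤ (Listₚ.map-cong
    (λ e₁ → sumFrom-ext (V ++ H) cellProduct-ext (single-cong P e₁ σ≗σ')) P)

  Acells : List Cell
  Acells = filterᵇ inA (cells n)

  -- Exactly the apex edges at t₁ and t₂ are set.
  base : Cell → Cell → Assignment
  base t₁ t₂ = single P (single Q σ₀ (ap₂ , t₂)) (ap₁ , t₁)

  Sig-apexes : Sig (Γ n A) x ≡ sumℤ (map (λ t₂ → sumℤ (map (λ t₁ → D (base t₁ t₂)) Acells)) Acells)
  Sig-apexes = begin
      Sig (Γ n A) x
    ≡⟨ sumAssign≡sumFrom internalG integrand ⟩
      sumFrom σ₀ internalG integrand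
    ≡⟨ cong (λ es → sumFrom σ₀ es integrand) internal≡ ⟩
      sumFrom σ₀ ((V ++ H) ++ P ++ Q) integrand
    ≡⟨ sumFrom-++ σ₀ (V ++ H) (P ++ Q) integrand ⟩
      sumFrom σ₀ (P ++ Q) (λ h → sumFrom h (V ++ H) integrand)
    ≡⟨ sumFrom-++ σ₀ P Q (λ h → sumFrom h (V ++ H) integrand) ⟩
      sumFrom σ₀ Q (λ h₂ → sumFrom h₂ P (λ h₁ → sumFrom h₁ (V ++ H) integrand))
    ≡⟨ sumFrom-cong σ₀ Q (λ h₂ _ → sum-over-P h₂) ⟩
      sumFrom σ₀ Q (λ h₂ → HW-Q h₂ * firstApex h₂)
    ≡⟨ sumFrom-HW₌₁ σ₀ Q firstApex (unique-edgesOf ap₂ inA) firstApex-ext ⟩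
      sumℤ (map (λ e₂ → firstApex (single Q σ₀ e₂)) Q)
    ≡⟨ cong sumℤ (sym (Listₚ.map-∘ Acells)) ⟩
      sumℤ (map (λ t₂ → firstApex (single Q σ₀ (ap₂ , t₂))) Acells)
    ≡⟨ cong sumℤ (Listₚ.map-cong (λ t₂ → cong sumℤ (sym (Listₚ.map-∘ Acells))) Acells) ⟩
      sumℤ (map (λ t₂ → sumℤ (map (λ t₁ → D (base t₁ t₂)) Acells)) Acells)
    ∎
    where open ≡-Reasoning

  _≟ᶜ_ : DecidableEquality Cell
  _≟ᶜ_ = ≡-dec Fin._≟_ Fin._≟_

  markOf : Cell → Fin n → Maybe (Fin n)
  markOf (i , j) = mark j i

  verticalIn : Cell → Cell → Fin n → ℕ → Bool
  verticalIn t₁ t₂ j = vertical (λ i → A i j) (xN x j) (markOf t₁ j) (markOf t₂ j)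

  -- The only assignment with apex edges at t₁, t₂ whose cell product can be nonzero.
  config : Cell → Cell → Assignment
  config t₁ t₂ (vert  , i , j) = if isLast i then false else verticalIn t₁ t₂ j (suc (toℕ i))
  config t₁ t₂ (horiz , i , j) = if isLast j then false else xW x i
  config t₁ t₂ (ap₁   , c)     = inA c ∧ does (c ≟ᶜ t₁)
  config t₁ t₂ (ap₂   , c)     = inA c ∧ does (c ≟ᶜ t₂)

  base-grid : ∀ t₁ t₂ {K} c → K ≢ ap₁ → K ≢ ap₂ → base t₁ t₂ (K , c) ≡ false
  base-grid t₁ t₂ {K} c K≢ap₁ K≢ap₂
    rewrite dec-false ((K , c) ∈? P) (kind-∉ K≢ap₁) | dec-false ((K , c) ∈? Q) (kind-∉ K≢ap₂) = refl

  base-ap₁ : ∀ t₁ t₂ c → base t₁ t₂ (ap₁ , c) ≡ inA c ∧ does (c ≟ᶜ t₁)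
  base-ap₁ t₁ t₂ c with inA c in c∈A
  ... | true  rewrite dec-true ((ap₁ , c) ∈? P) (∈-edgesOf ap₁ inA c∈A) = refl
  ... | false rewrite dec-false ((ap₁ , c) ∈? P) (∉-edgesOf c∈A)
                    | dec-false ((ap₁ , c) ∈? Q) (kind-∉ λ ()) = refl

  base-ap₂ : ∀ t₁ t₂ c → base t₁ t₂ (ap₂ , c) ≡ inA c ∧ does (c ≟ᶜ t₂)
  base-ap₂ t₁ t₂ c rewrite dec-false ((ap₂ , c) ∈? P) (kind-∉ λ ()) with inA c in c∈A
  ... | true  rewrite dec-true ((ap₂ , c) ∈? Q) (∈-edgesOf ap₂ inA c∈A) = refl
  ... | false rewrite dec-false ((ap₂ , c) ∈? Q) (∉-edgesOf c∈A) = refl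

  config-agreeOff : ∀ t₁ t₂ → AgreeOff (V ++ H) (config t₁ t₂) (base t₁ t₂)
  config-agreeOff t₁ t₂ (vert , i , j) e∉ with isLast i in last
  ... | true  = sym (base-grid t₁ t₂ (i , j) (λ ()) (λ ()))
  ... | false = ⊥-elim (e∉ (∈-++⁺ˡ (∈-edgesOf vert _ (cong not last))))
  config-agreeOff t₁ t₂ (horiz , i , j) e∉ with isLast j in last
  ... | true  = sym (base-grid t₁ t₂ (i , j) (λ ()) (λ ()))
  ... | false = ⊥-elim (e∉ (∈-++⁺ʳ V (∈-edgesOf horiz _ (cong not last))))
  config-agreeOff t₁ t₂ (ap₁ , c) _ = sym (base-ap₁ t₁ t₂ c)
  config-agreeOff t₁ t₂ (ap₂ , c) _ = sym (base-ap₂ t₁ t₂ c)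

  _at_ : Assignment → GDang n ⊎ GEdge n → Bool
  g at e = [ x , g ] e

  cellAt≡cell : ∀ g i j → cellAt g (i , j) ≡ cell (A i j) (g at northE i j) (g at eastE i j) (g at southE i j)
                                                          (g at westE i j) (g (ap₁ , i , j)) (g (ap₂ , i , j))
  cellAt≡cell g i j with A i j
  ... | true  = refl
  ... | false = refl

  cellAt-nonzero : ∀ g i j → cellAt g (i , j) ≢ 0ℤ →
                   g at southE i j ≡ (A i j ∧ g (ap₁ , i , j)) xor ((A i j ∧ g (ap₂ , i , j)) xor g at northE i j)
                   × g at eastE i j ≡ g at westE i j
  cellAt-nonzero g i j cellAt≢0 =
    cell-nonzero (A i j) (g at northE i j) (g at eastE i j) (g at southE i j) (g at westE i j)
                 (g (ap₁ , i , j)) (g (ap₂ , i , j)) λ cell≡0 → cellAt≢0 (trans (cellAt≡cell g i j) cell≡0)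

  apex-flag : ∀ t i j → inA (i , j) ∧ does ((i , j) ≟ᶜ t) ≡ flag (λ i' → A i' j) (markOf t j) (toℕ i)
  apex-flag (i₁ , j₁) i j with (i , j) ≟ᶜ (i₁ , j₁)
  ... | yes refl rewrite dec-true (j Fin.≟ j) refl | toℕ-≡ᵇ i i | dec-true (i Fin.≟ i) refl = ∧-identityʳ (A i j)
  ... | no ij≢t rewrite ∧-zeroʳ (A i j) with j₁ Fin.≟ j
  ...   | no _     = refl
  ...   | yes refl rewrite toℕ-≡ᵇ i₁ i | dec-false (i₁ Fin.≟ i) (λ { refl → ij≢t refl }) = refl

  apex-mask : ∀ t i j → A i j ∧ (inA (i , j) ∧ does ((i , j) ≟ᶜ t)) ≡ flag (λ i' → A i' j) (markOf t j) (toℕ i)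
  apex-mask t i j = trans (sym (∧-assoc (A i j) (A i j) _))
                          (trans (cong (_∧ does ((i , j) ≟ᶜ t)) (∧-idem (A i j))) (apex-flag t i j))

  isLast-inject₁ : ∀ {m} (i : Fin m) → isLast (inject₁ i) ≡ false
  isLast-inject₁ {suc m} Fin.zero    = refl
  isLast-inject₁ {suc m} (Fin.suc i) = isLast-inject₁ i

  southE-inner : ∀ {i} j → isLast i ≡ false → southE i j ≡ inj₂ (vert , i , j)
  southE-inner j last rewrite last = refl

  eastE-inner : ∀ i {j} → isLast j ≡ false → eastE i j ≡ inj₂ (horiz , i , j)
  eastE-inner i last rewrite last = refl

  module Rigidity (t₁ t₂ : Cell) (g : Assignment) (g≈base : AgreeOff (V ++ H) g (base t₁ t₂))
                  (nonzero : cellProduct g ≢ 0ℤ) where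

    local : ∀ i j → g at southE i j ≡ (A i j ∧ g (ap₁ , i , j)) xor ((A i j ∧ g (ap₂ , i , j)) xor g at northE i j)
                  × g at eastE i j ≡ g at westE i j
    local i j = cellAt-nonzero g i j λ cell≡0 → nonzero (prodℤ-zero (cellAt g) (∈cells (i , j)) cell≡0)

    apex : ∀ K t i j → base t₁ t₂ (K , i , j) ≡ inA (i , j) ∧ does ((i , j) ≟ᶜ t) → (K , i , j) ∉ V ++ H →
           A i j ∧ g (K , i , j) ≡ flag (λ i' → A i' j) (markOf t j) (toℕ i)
    apex K t i j base≡ ∉VH = trans (cong (A i j ∧_) (trans (g≈base _ ∉VH) base≡)) (apex-mask t i j)

    south : ∀ i j → g at southE i j ≡ flag (λ i' → A i' j) (markOf t₁ j) (toℕ i)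
                                        xor (flag (λ i' → A i' j) (markOf t₂ j) (toℕ i) xor g at northE i j)
    south i j = trans (proj₁ (local i j))
      (cong₂ (λ e₁ e₂ → e₁ xor (e₂ xor g at northE i j))
             (apex ap₁ t₁ i j (base-ap₁ t₁ t₂ (i , j)) (ap₁∉VH (i , j)))
             (apex ap₂ t₂ i j (base-ap₂ t₁ t₂ (i , j)) (ap₂∉VH (i , j))))

    north : ∀ k i j → toℕ i ≡ k → g at northE i j ≡ verticalIn t₁ t₂ j k
    north zero    Fin.zero    j _   = refl
    north (suc k) (Fin.suc i) j i≡k = begin
        g (vert , inject₁ i , j)
      ≡⟨ cong (g at_) (sym (southE-inner j (isLast-inject₁ i))) ⟩
        g at southE (inject₁ i) j
      ≡⟨ south (inject₁ i) j ⟩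
        flag c (markOf t₁ j) (toℕ (inject₁ i)) xor (flag c (markOf t₂ j) (toℕ (inject₁ i)) xor g at northE (inject₁ i) j)
      ≡⟨ cong₂ (λ r v → flag c (markOf t₁ j) r xor (flag c (markOf t₂ j) r xor v)) i'≡k (north k (inject₁ i) j i'≡k) ⟩
        verticalIn t₁ t₂ j (suc k)
      ∎
      where
      open ≡-Reasoning
      c = λ i' → A i' j
      i'≡k = trans (toℕ-inject₁ i) (ℕP.suc-injective i≡k)

    west : ∀ k i j → toℕ j ≡ k → g at westE i j ≡ xW x i
    west zero    i Fin.zero    _   = refl
    west (suc k) i (Fin.suc j) j≡k = begin
        g (horiz , i , inject₁ j)    ≡⟨ cong (g at_) (sym (eastE-inner i (isLast-inject₁ j))) ⟩
        g at eastE i (inject₁ j)     ≡⟨ proj₂ (local i (inject₁ j)) ⟩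
        g at westE i (inject₁ j)     ≡⟨ west k i (inject₁ j) (trans (toℕ-inject₁ j) (ℕP.suc-injective j≡k)) ⟩
        xW x i                       ∎
      where open ≡-Reasoning

    rigid : g ≗ config t₁ t₂
    rigid (vert , i , j) with isLast i in last
    ... | true  = trans (g≈base _ (∉-++ (∉-edgesOf (cong not last)) (kind-∉ λ ()))) (base-grid t₁ t₂ (i , j) (λ ()) (λ ()))
    ... | false = trans (cong (g at_) (sym (southE-inner j last)))
                        (trans (south i j) (cong (λ v → flag (λ i' → A i' j) (markOf t₁ j) (toℕ i)
                                                   xor (flag (λ i' → A i' j) (markOf t₂ j) (toℕ i) xor v))
                                              (north (toℕ i) i j refl)))
    rigid (horiz , i , j) with isLast j in last
    ... | true  = trans (g≈base _ (∉-++ (kind-∉ λ ()) (∉-edgesOf (cong not last)))) (base-grid t₁ t₂ (i , j) (λ ()) (λ ()))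
    ... | false = trans (cong (g at_) (sym (eastE-inner i last)))
                        (trans (proj₂ (local i j)) (west (toℕ j) i j refl))
    rigid (ap₁ , c) = trans (g≈base _ (ap₁∉VH c)) (base-ap₁ t₁ t₂ c)
    rigid (ap₂ , c) = trans (g≈base _ (ap₂∉VH c)) (base-ap₂ t₁ t₂ c)

  D-base : ∀ t₁ t₂ → D (base t₁ t₂) ≡ cellProduct (config t₁ t₂)
  D-base t₁ t₂ = sumFrom-delta (base t₁ t₂) (V ++ H) (config t₁ t₂) unique-VH cellProduct-ext
                               (config-agreeOff t₁ t₂) (Rigidity.rigid t₁ t₂)

  Sig-configurations : Sig (Γ n A) x ≡ sumℤ (map (λ t₂ → sumℤ (map (λ t₁ → cellProduct (config t₁ t₂)) Acells)) Acells)
  Sig-configurations = trans Sig-apexes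
    (cong sumℤ (Listₚ.map-cong (λ t₂ → cong sumℤ (Listₚ.map-cong (λ t₁ → D-base t₁ t₂) Acells)) Acells))

  config-west : ∀ t₁ t₂ i j → config t₁ t₂ at westE i j ≡ xW x i
  config-west t₁ t₂ i Fin.zero    = refl
  config-west t₁ t₂ i (Fin.suc j) rewrite isLast-inject₁ j = refl

  config-east : ∀ t₁ t₂ i j → isLast j ≡ true → config t₁ t₂ at eastE i j ≡ xE x i
  config-east t₁ t₂ i j last rewrite last = refl

  sum-Acells : ∀ (G : Cell → ℤ) → sumℤ (map G Acells) ≡ ∑∑⟨ (λ j i → A i j) ⟩ (λ j i → G (i , j))
  sum-Acells G = begin
      sumℤ (map G Acells)
    ≡⟨ sumℤ-filter G inA (cells n) ⟩
      sumℤ (map (λ c → when (inA c) (G c)) (cells n))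
    ≡⟨ ∑List.fold-map-cartesianProduct (λ c → when (inA c) (G c)) (allFin n) (allFin n) ⟩
      sumℤ (map (λ i → sumℤ (map (λ j → when (A i j) (G (i , j))) (allFin n))) (allFin n))
    ≡⟨ cong sumℤ (Listₚ.map-cong (λ i → ∑List.fold-map-tabulate (λ j → when (A i j) (G (i , j))) (λ j → j)) (allFin n)) ⟩
      sumℤ (map (λ i → ∑ λ j → when (A i j) (G (i , j))) (allFin n))
    ≡⟨ ∑List.fold-map-tabulate (λ i → ∑ λ j → when (A i j) (G (i , j))) (λ i → i) ⟩
      ∑ (λ i → ∑ λ j → when (A i j) (G (i , j)))
    ≡⟨ ∑-comm (λ i j → when (A i j) (G (i , j))) ⟩
      ∑∑⟨ (λ j i → A i j) ⟩ (λ j i → G (i , j))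
    ∎
    where open ≡-Reasoning

  module Columns (h : Fin n → Bool) (W≗h : xW x ≗ h) (E≗h : xE x ≗ h) where

    weightOf : Fin n → Bool → Maybe (Fin n) → Maybe (Fin n) → ℤ
    weightOf j = Column.weight (λ i → A i j) h (xS x j)

    cellAt-config : ∀ t₁ t₂ i j → cellAt (config t₁ t₂) (i , j)
                    ≡ Column.rowWeight (λ i' → A i' j) h (xS x j) (xN x j) (markOf t₁ j) (markOf t₂ j) i
    cellAt-config t₁ t₂ i j = begin
        cellAt g (i , j)
      ≡⟨ cellAt≡cell g i j ⟩
        cell (A i j) (g at northE i j) (g at eastE i j) (g at southE i j) (g at westE i j) (g (ap₁ , i , j)) (g (ap₂ , i , j))
      ≡⟨ cell-mask (A i j) _ _ _ _ _ _ ⟩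
        cell (A i j) (g at northE i j) (g at eastE i j) (g at southE i j) (g at westE i j)
             (A i j ∧ g (ap₁ , i , j)) (A i j ∧ g (ap₂ , i , j))
      ≡⟨ cong₂ (cell (A i j) (g at northE i j) (g at eastE i j) (g at southE i j) (g at westE i j))
               (apex-mask t₁ i j) (apex-mask t₂ i j) ⟩
        cell (A i j) (g at northE i j) (g at eastE i j) (g at southE i j) (g at westE i j) (f t₁) (f t₂)
      ≡⟨ cong₂ (λ N S → cell (A i j) N (g at eastE i j) S (g at westE i j) (f t₁) (f t₂)) (north i) south ⟩
        cell (A i j) (v (toℕ i)) (g at eastE i j) (if isLast i then xS x j else v (suc (toℕ i))) (g at westE i j) (f t₁) (f t₂)
      ≡⟨ cong₂ (λ E W → cell (A i j) (v (toℕ i)) E (if isLast i then xS x j else v (suc (toℕ i))) W (f t₁) (f t₂))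
               east (trans (config-west t₁ t₂ i j) (W≗h i)) ⟩
        Column.rowWeight (λ i' → A i' j) h (xS x j) (xN x j) (markOf t₁ j) (markOf t₂ j) i
      ∎
      where
      open ≡-Reasoning
      g = config t₁ t₂
      v = verticalIn t₁ t₂ j
      f : Cell → Bool
      f t = flag (λ i' → A i' j) (markOf t j) (toℕ i)
      north : ∀ i → g at northE i j ≡ v (toℕ i)
      north Fin.zero    = refl
      north (Fin.suc i) rewrite isLast-inject₁ i | toℕ-inject₁ i = refl
      south : g at southE i j ≡ (if isLast i then xS x j else v (suc (toℕ i)))
      south with isLast i in last
      ... | true  = refl
      ... | false rewrite last = refl
      east : g at eastE i j ≡ h i
      east with isLast j in last
      ... | true  = E≗h i
      ... | false rewrite last = W≗h i

    cellProduct-config : ∀ t₁ t₂ → cellProduct (config t₁ t₂) ≡ ∏ λ j → weightOf j (xN x j) (markOf t₁ j) (markOf t₂ j)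
    cellProduct-config t₁ t₂ = begin
        cellProduct g
      ≡⟨ ∏List.fold-map-cartesianProduct (cellAt g) (allFin n) (allFin n) ⟩
        prodℤ (map (λ i → prodℤ (map (λ j → cellAt g (i , j)) (allFin n))) (allFin n))
      ≡⟨ cong prodℤ (Listₚ.map-cong (λ i → ∏List.fold-map-tabulate (λ j → cellAt g (i , j)) (λ j → j)) (allFin n)) ⟩
        prodℤ (map (λ i → ∏ λ j → cellAt g (i , j)) (allFin n))
      ≡⟨ ∏List.fold-map-tabulate (λ i → ∏ λ j → cellAt g (i , j)) (λ i → i) ⟩
        ∏ (λ i → ∏ λ j → cellAt g (i , j))
      ≡⟨ ∏-comm (λ i j → cellAt g (i , j)) ⟩
        ∏ (λ j → ∏ λ i → cellAt g (i , j))
      ≡⟨ ∏-cong (λ j → ∏-cong λ i → cellAt-config t₁ t₂ i j) ⟩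
        ∏ (λ j → weightOf j (xN x j) (markOf t₁ j) (markOf t₂ j))
      ∎
      where
      open ≡-Reasoning
      g = config t₁ t₂

    Sig-columns : Sig (Γ n A) x ≡ cₛₜ (∏⊗ λ j → Column.column (λ i → A i j) h (xS x j) (xN x j))
    Sig-columns = begin
        Sig (Γ n A) x
      ≡⟨ Sig-configurations ⟩
        sumℤ (map (λ t₂ → sumℤ (map (λ t₁ → cellProduct (config t₁ t₂)) Acells)) Acells)
      ≡⟨ sum-Acells _ ⟩
        ∑∑⟨ w ⟩ (λ j₂ i₂ → sumℤ (map (λ t₁ → cellProduct (config t₁ (i₂ , j₂))) Acells))
      ≡⟨ ∑-cong (λ j₂ → ∑-cong λ i₂ → cong (when (A i₂ j₂)) (trans (sum-Acells _)
           (∑-cong λ j₁ → ∑-cong λ i₁ → cong (when (A i₁ j₁)) (cellProduct-config (i₁ , j₁) (i₂ , j₂))))) ⟩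
        ∑∑⟨ w ⟩ (λ j₂ i₂ → ∑∑⟨ w ⟩ λ j₁ i₁ → ∏ λ j → weightOf j (xN x j) (mark j₁ i₁ j) (mark j₂ i₂ j))
      ≡⟨ ∏tuple-cₛₜ w (λ j → weightOf j (xN x j)) ⟨
        cₛₜ (∏⊗ λ j → Column.column (λ i → A i j) h (xS x j) (xN x j))
      ∎
      where
      open ≡-Reasoning
      w = λ j i → A i j

sumℤ-zero : ∀ {X : Set} (f : X → ℤ) l → (∀ a → f a ≡ 0ℤ) → sumℤ (map f l) ≡ 0ℤ
sumℤ-zero f []      f≡0 = refl
sumℤ-zero f (a ∷ l) f≡0 rewrite f≡0 a | sumℤ-zero f l f≡0 = refl

isLast-fromℕ : ∀ m → isLast (fromℕ m) ≡ true
isLast-fromℕ zero    = refl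
isLast-fromℕ (suc m) = isLast-fromℕ m

cₛₜ-pure-s : ∀ G R → cₛₜ (⟨ 0ℤ , G , 0ℤ , 0ℤ ⟩ ⊗ R) ≡ G * cₜ R
cₛₜ-pure-s G ⟨ r₁ , rₛ , rₜ , rₛₜ ⟩ = lemma G r₁ rₛ rₜ rₛₜ
  where
  lemma : ∀ G r₁ rₛ rₜ rₛₜ → 0ℤ * rₛₜ + G * rₜ + 0ℤ * rₛ + 0ℤ * r₁ ≡ G * rₜ
  lemma = solve-∀

cₛₜ-pure-t : ∀ F R → cₛₜ (⟨ 0ℤ , 0ℤ , F , 0ℤ ⟩ ⊗ R) ≡ F * cₛ R
cₛₜ-pure-t F ⟨ r₁ , rₛ , rₜ , rₛₜ ⟩ = lemma F r₁ rₛ rₜ rₛₜ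
  where
  lemma : ∀ F r₁ rₛ rₜ rₛₜ → 0ℤ * rₛₜ + 0ℤ * rₜ + F * rₛ + 0ℤ * r₁ ≡ F * rₛ
  lemma = solve-∀

found-other : ∀ {n} {a : Bool} (j k : Fin n) → a ∧ not (does (j Fin.≟ k)) ≡ true → a ≡ true × j ≢ k
found-other {a = true} j k eq with j Fin.≟ k
... | no j≢k = refl , j≢k
... | yes _  with () ← eq
found-other {a = false} j k ()

none-other : ∀ {n} {a : Bool} {j k : Fin n} → a ∧ not (does (j Fin.≟ k)) ≡ false → j ≢ k → a ≡ false
none-other {a = a} {j} {k} eq j≢k rewrite dec-false (j Fin.≟ k) j≢k = trans (sym (∧-identityʳ a)) eq

isIdx-intro : ∀ {n} (s : Fin n → Bool) w → s w ≡ true → (∀ j → j ≢ w → s j ≡ false) → s isIdx w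
isIdx-intro s w sw others j with j Fin.≟ w
... | yes refl = sw
... | no j≢w   = others j j≢w

module Final (m : ℕ) (A : Fin (suc m) → Fin (suc m) → Bool) (x : GDang (suc m) → Bool) where

  n : ℕ
  n = suc m

  open Quantities A
  open GridSum n A x using (Acells; cellProduct; config; cellAt; cellAt-nonzero; ∈cells; _at_;
                            config-west; config-east; Sig-configurations; module Columns)

  Sig-zero-if-W≢E : ∀ i → xW x i ≢ xE x i → Sig (Γ n A) x ≡ 0ℤ
  Sig-zero-if-W≢E i W≢E = trans Sig-configurations
    (sumℤ-zero _ Acells λ t₂ → sumℤ-zero _ Acells λ t₁ →
      prodℤ-zero (cellAt (config t₁ t₂)) (∈cells (i , fromℕ m)) (east-cell-zero t₁ t₂))
    where
    east-cell-zero : ∀ t₁ t₂ → cellAt (config t₁ t₂) (i , fromℕ m) ≡ 0ℤ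
    east-cell-zero t₁ t₂ = decidable-stable (cellAt g (i , fromℕ m) ℤ.≟ 0ℤ) λ cell≢0 →
      W≢E (trans (sym (config-west t₁ t₂ i (fromℕ m)))
          (trans (sym (proj₂ (cellAt-nonzero g i (fromℕ m) cell≢0)))
                 (config-east t₁ t₂ i (fromℕ m) (isLast-fromℕ m))))
      where g = config t₁ t₂

  module SignalRow (u : Fin n) (W-u : xW x isIdx u) (W≐E : xW x ≐ xE x) where

    U α₂ β₂ X : Fin n → ℤ
    U z = when (A u z) 1ℤ
    α₂ z = + (αℕ u z C 2)
    β₂ z = + (βℕ u z C 2)
    X z = α₂ z + β₂ z + U z * (α u z + β u z) - α u z * β u z

    τ : Fin n → ℤst
    τ j = crossed (α u j) (U j) (β u j) (α₂ j) (β₂ j) (xN x j) (xS x j)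

    Sig≡∏τ : Sig (Γ n A) x ≡ cₛₜ (∏⊗ τ)
    Sig≡∏τ = trans (Columns.Sig-columns (λ i → does (i Fin.≟ u)) W-u (λ i → trans (sym (W≐E i)) (W-u i)))
                   (cong cₛₜ (∏⊗-cong λ j → trans (column-crossed m (λ i → A i j) u (xS x j) (xN x j)) (counts j)))
      where
      counts : ∀ j → crossed (+ countAbove (λ i → A i j) u) (U j) (+ countBelow (λ i → A i j) u)
                             (+ (countAbove (λ i → A i j) u C 2)) (+ (countBelow (λ i → A i j) u C 2)) (xN x j) (xS x j)
                     ≡ τ j
      counts j rewrite hw-map-tabulate (λ i → (toℕ i <ᵇ toℕ u) ∧ A i j) (λ i → i)
                     | hw-map-tabulate (λ i → (toℕ u <ᵇ toℕ i) ∧ A i j) (λ i → i) = refl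

    diagonal : ∀ j → xN x j ≡ false → xS x j ≡ false → τ j ≡ ⟨ 1ℤ , 0ℤ , 0ℤ , X j ⟩
    diagonal j N≡ S≡ rewrite N≡ | S≡ = refl

    cₜ-zero : ∀ j → xN x j ≡ false ⊎ xS x j ≡ true → cₜ (τ j) ≡ 0ℤ
    cₜ-zero j N⊎S with xN x j | xS x j | N⊎S
    ... | false | false | _ = refl
    ... | false | true  | _ = refl
    ... | true  | true  | _ = refl
    ... | true  | false | inj₁ ()
    ... | true  | false | inj₂ ()

    module NorthAt (v : Fin n) (N-v : xN x isIdx v) where

      N-other : ∀ {j} → j ≢ v → xN x j ≡ false
      N-other {j} j≢v = trans (N-v j) (dec-false (j Fin.≟ v) j≢v)

      N-here : xN x v ≡ true
      N-here = trans (N-v v) (dec-true (v Fin.≟ v) refl)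

      s-column : ∀ {j} → j ≢ v → xS x j ≡ true → τ j ≡ ⟨ 0ℤ , β u j + U j - α u j , 0ℤ , 0ℤ ⟩
      s-column j≢v S≡ rewrite N-other j≢v | S≡ = refl

      south-one-hot : ∀ w → xS x w ≡ true → (∀ j → j ≢ w → xS x j ≡ false) → hwF (xS x) ≡ 1
      south-one-hot w Sw others = trans (hwF≡count (xS x)) (isIdx⇒count≡1 (xS x) (isIdx-intro (xS x) w Sw others))

      -- A second column with south value 1 carries s as well, and s² = 0.
      Sig-zero-if-south-off-v : ∀ w → xS x w ≡ true → w ≢ v → hwF (xS x) ≢ 1 → Sig (Γ n A) x ≡ 0ℤ
      Sig-zero-if-south-off-v w Sw w≢v hw≢1 = begin
          Sig (Γ n A) x                                  ≡⟨ Sig≡∏τ ⟩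
          cₛₜ (∏⊗ τ)                                     ≡⟨ cong cₛₜ (∏⊗-extract τ w) ⟩
          cₛₜ (τ w ⊗ ∏⊗ (erase 𝟙 τ w))                  ≡⟨ cong (λ t → cₛₜ (t ⊗ ∏⊗ (erase 𝟙 τ w))) (s-column w≢v Sw) ⟩
          cₛₜ (⟨ 0ℤ , G , 0ℤ , 0ℤ ⟩ ⊗ ∏⊗ (erase 𝟙 τ w))  ≡⟨ cₛₜ-pure-s G (∏⊗ (erase 𝟙 τ w)) ⟩
          G * cₜ (∏⊗ (erase 𝟙 τ w))                     ≡⟨ cong (G *_) no-t ⟩
          G * 0ℤ                                         ≡⟨ ℤP.*-zeroʳ G ⟩
          0ℤ                                             ∎
        where
        open ≡-Reasoning
        G = β u w + U w - α u w
        no-t : cₜ (∏⊗ (erase 𝟙 τ w)) ≡ 0ℤ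
        no-t with xS x v in Sv
        ... | true = ∏⊗-cₜ-zero (erase 𝟙 τ w) others
          where
          others : ∀ j → cₜ (erase 𝟙 τ w j) ≡ 0ℤ
          others j with j Fin.≟ w | j Fin.≟ v
          ... | yes _ | _        = refl
          ... | no _  | yes refl = cₜ-zero j (inj₂ Sv)
          ... | no _  | no j≢v   = cₜ-zero j (inj₁ (N-other j≢v))
        ... | false with search (λ j → xS x j ∧ not (does (j Fin.≟ w)))
        ...   | inj₂ none = ⊥-elim (hw≢1 (south-one-hot w Sw λ j j≢w → none-other (none j) j≢w))
        ...   | inj₁ (w' , found) = cong cₜ (trans (∏⊗-extract (erase 𝟙 τ w) w')
                                      (cong (_⊗ ∏⊗ (erase 𝟙 (erase 𝟙 τ w) w')) column-w'))
          where
          Sw' = proj₁ (found-other w' w found)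
          w'≢v : w' ≢ v
          w'≢v refl with () ← trans (sym Sw') Sv
          column-w' : erase 𝟙 τ w w' ≡ ⟨ 0ℤ , β u w' + U w' - α u w' , 0ℤ , 0ℤ ⟩
          column-w' rewrite dec-false (w' Fin.≟ w) (proj₂ (found-other w' w found)) = s-column w'≢v Sw'

      Sig-zero-if-south-only-at-v : (∀ j → j ≢ v → xS x j ≡ false) → hwF (xS x) ≢ 1 → Sig (Γ n A) x ≡ 0ℤ
      Sig-zero-if-south-only-at-v S-off hw≢1 with xS x v in Sv
      ... | true  = ⊥-elim (hw≢1 (south-one-hot v Sv S-off))
      ... | false = begin
          Sig (Γ n A) x                                  ≡⟨ Sig≡∏τ ⟩
          cₛₜ (∏⊗ τ)                                     ≡⟨ cong cₛₜ (∏⊗-extract τ v) ⟩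
          cₛₜ (τ v ⊗ ∏⊗ (erase 𝟙 τ v))                  ≡⟨ cong (λ t → cₛₜ (t ⊗ ∏⊗ (erase 𝟙 τ v))) t-column ⟩
          cₛₜ (⟨ 0ℤ , 0ℤ , F , 0ℤ ⟩ ⊗ ∏⊗ (erase 𝟙 τ v))  ≡⟨ cₛₜ-pure-t F (∏⊗ (erase 𝟙 τ v)) ⟩
          F * cₛ (∏⊗ (erase 𝟙 τ v))                     ≡⟨ cong (F *_) (∏⊗-cₛ-zero (erase 𝟙 τ v) no-s) ⟩
          F * 0ℤ                                         ≡⟨ ℤP.*-zeroʳ F ⟩
          0ℤ                                             ∎
        where
        open ≡-Reasoning
        F = α u v + U v - β u v
        t-column : τ v ≡ ⟨ 0ℤ , 0ℤ , F , 0ℤ ⟩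
        t-column rewrite N-here | Sv = refl
        no-s : ∀ j → cₛ (erase 𝟙 τ v j) ≡ 0ℤ
        no-s j with j Fin.≟ v
        ... | yes _  = refl
        ... | no j≢v = cong cₛ (diagonal j (N-other j≢v) (S-off j j≢v))

      Sig-zero-if-south-not-one-hot : hwF (xS x) ≢ 1 → Sig (Γ n A) x ≡ 0ℤ
      Sig-zero-if-south-not-one-hot hw≢1 with search (λ j → xS x j ∧ not (does (j Fin.≟ v)))
      ... | inj₁ (w , found) = Sig-zero-if-south-off-v w (proj₁ (found-other w v found)) (proj₂ (found-other w v found)) hw≢1
      ... | inj₂ none        = Sig-zero-if-south-only-at-v (λ j → none-other (none j)) hw≢1

    sumFin≡∑ : ∀ (g : Fin n → ℤ) → sumFin g ≡ ∑ g
    sumFin≡∑ g = ∑List.fold-map-tabulate g (λ i → i)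

    module SameColumn (v : Fin n) (N-v : xN x isIdx v) (S-v : xS x isIdx v) where

      Y : ℤ
      Y = α u v * β u v + U v * (α u v + β u v) + U v - (α u v + β u v) - α₂ v - β₂ v

      Sig≡Y-∑X : Sig (Γ n A) x ≡ Y - ∑ (erase 0ℤ X v)
      Sig≡Y-∑X = begin
          Sig (Γ n A) x                                           ≡⟨ Sig≡∏τ ⟩
          cₛₜ (∏⊗ τ)                                              ≡⟨ cong cₛₜ (∏⊗-extract τ v) ⟩
          cₛₜ (τ v ⊗ ∏⊗ (erase 𝟙 τ v))                           ≡⟨ cong₂ (λ t P → cₛₜ (t ⊗ P)) column-v others ⟩
          cₛₜ (⟨ - 1ℤ , 0ℤ , 0ℤ , Y ⟩ ⊗ ⟨ 1ℤ , 0ℤ , 0ℤ , ∑ (erase 0ℤ X v) ⟩) ≡⟨ expand Y (∑ (erase 0ℤ X v)) ⟩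
          Y - ∑ (erase 0ℤ X v)                                    ∎
        where
        open ≡-Reasoning
        column-v : τ v ≡ ⟨ - 1ℤ , 0ℤ , 0ℤ , Y ⟩
        column-v rewrite N-v v | S-v v | dec-true (v Fin.≟ v) refl = refl
        others : ∏⊗ (erase 𝟙 τ v) ≡ ⟨ 1ℤ , 0ℤ , 0ℤ , ∑ (erase 0ℤ X v) ⟩
        others = trans (∏⊗-cong diag) (∏⊗-diagonal (erase 0ℤ X v))
          where
          diag : ∀ j → erase 𝟙 τ v j ≡ ⟨ 1ℤ , 0ℤ , 0ℤ , erase 0ℤ X v j ⟩
          diag j with j Fin.≟ v
          ... | yes _  = refl
          ... | no j≢v = diagonal j (trans (N-v j) (dec-false (j Fin.≟ v) j≢v)) (trans (S-v j) (dec-false (j Fin.≟ v) j≢v))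
        expand : ∀ Y Σ → - 1ℤ * Σ + 0ℤ * 0ℤ + 0ℤ * 0ℤ + Y * 1ℤ ≡ Y - Σ
        expand = solve-∀

      D R S : Fin n → ℤ
      D z = α u z * β u z - α₂ z - β₂ z
      R z = when (A u z) (β u z)
      S z = when (A u z) (α u z)

      q≡ : q u ≡ D v + ∑ (erase 0ℤ D v)
      q≡ = trans (sumFin≡∑ D) (sum-erase ℤP.+-0-commutativeMonoid D v)

      r≡ : r u v ≡ ∑ (erase 0ℤ R v)
      r≡ = trans (sumFin≡∑ λ z → if not (does (z Fin.≟ v)) ∧ A u z then β u z else 0ℤ) (∑-cong outside)
        where
        outside : ∀ z → (if not (does (z Fin.≟ v)) ∧ A u z then β u z else 0ℤ) ≡ erase 0ℤ R v z
        outside z with z Fin.≟ v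
        ... | yes _ = refl
        ... | no _  = refl

      s≡ : s u v ≡ ∑ (erase 0ℤ S v)
      s≡ = trans (sumFin≡∑ λ z → if not (does (z Fin.≟ v)) ∧ A u z then α u z else 0ℤ) (∑-cong outside)
        where
        outside : ∀ z → (if not (does (z Fin.≟ v)) ∧ A u z then α u z else 0ℤ) ≡ erase 0ℤ S v z
        outside z with z Fin.≟ v
        ... | yes _ = refl
        ... | no _  = refl

      -- X z + D z = U z * (α u z + β u z), and U z is the indicator of (u, z) ∈ A.
      X+D≡R+S : ∑ (erase 0ℤ X v) + ∑ (erase 0ℤ D v) ≡ ∑ (erase 0ℤ R v) + ∑ (erase 0ℤ S v)
      X+D≡R+S = begin
          ∑ (erase 0ℤ X v) + ∑ (erase 0ℤ D v)                   ≡⟨ ∑-distrib-+ (erase 0ℤ X v) (erase 0ℤ D v) ⟨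
          ∑ (λ z → erase 0ℤ X v z + erase 0ℤ D v z)             ≡⟨ ∑-cong pointwise ⟩
          ∑ (λ z → erase 0ℤ R v z + erase 0ℤ S v z)             ≡⟨ ∑-distrib-+ (erase 0ℤ R v) (erase 0ℤ S v) ⟩
          ∑ (erase 0ℤ R v) + ∑ (erase 0ℤ S v)                   ∎
        where
        open ≡-Reasoning
        pointwise : ∀ z → erase 0ℤ X v z + erase 0ℤ D v z ≡ erase 0ℤ R v z + erase 0ℤ S v z
        pointwise z with z Fin.≟ v
        ... | yes _ = refl
        ... | no _ with A u z
        ...   | true  = apex (α u z) (β u z) (α₂ z) (β₂ z)
          where
          apex : ∀ a b a₂ b₂ → a₂ + b₂ + 1ℤ * (a + b) - a * b + (a * b - a₂ - b₂) ≡ b + a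
          apex = solve-∀
        ...   | false = plain (α u z) (β u z) (α₂ z) (β₂ z)
          where
          plain : ∀ a b a₂ b₂ → a₂ + b₂ + 0ℤ * (a + b) - a * b + (a * b - a₂ - b₂) ≡ 0ℤ + 0ℤ
          plain = solve-∀

      Sig≡ : Sig (Γ n A) x ≡ Y - (∑ (erase 0ℤ R v) + ∑ (erase 0ℤ S v) - ∑ (erase 0ℤ D v))
      Sig≡ = trans Sig≡Y-∑X (cong (λ z → Y - z) (trans (add-sub (∑ (erase 0ℤ X v)) (∑ (erase 0ℤ D v)))
                                               (cong (_- ∑ (erase 0ℤ D v)) X+D≡R+S)))
        where
        add-sub : ∀ a b → a ≡ a + b - b
        add-sub = solve-∀

      Yof : ℤ → ℤ
      Yof t = α u v * β u v + t * (α u v + β u v) + t - (α u v + β u v) - α₂ v - β₂ v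

      ΣD ΣR ΣS : ℤ
      ΣD = ∑ (erase 0ℤ D v)
      ΣR = ∑ (erase 0ℤ R v)
      ΣS = ∑ (erase 0ℤ S v)

      Sig-at : ∀ {b} → A u v ≡ b → Sig (Γ n A) x ≡ Yof (when b 1ℤ) - (ΣR + ΣS - ΣD)
      Sig-at refl = Sig≡

      qrs≡ : q u - r u v - s u v ≡ D v + ΣD - ΣR - ΣS
      qrs≡ = cong₂ _-_ (cong₂ _-_ q≡ r≡) s≡

      off-A : A u v ≡ false → Sig (Γ n A) x ≡ q u - r u v - s u v - α u v - β u v
      off-A Auv = begin
          Sig (Γ n A) x                                   ≡⟨ Sig-at Auv ⟩
          Yof 0ℤ - (ΣR + ΣS - ΣD)                         ≡⟨ identity (α u v) (β u v) (α₂ v) (β₂ v) ΣD ΣR ΣS ⟩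
          D v + ΣD - ΣR - ΣS - α u v - β u v              ≡⟨ cong (λ t → t - α u v - β u v) qrs≡ ⟨
          q u - r u v - s u v - α u v - β u v             ∎
        where
        open ≡-Reasoning
        identity : ∀ a b a₂ b₂ ΣD ΣR ΣS →
                   a * b + 0ℤ * (a + b) + 0ℤ - (a + b) - a₂ - b₂ - (ΣR + ΣS - ΣD)
                   ≡ a * b - a₂ - b₂ + ΣD - ΣR - ΣS - a - b
        identity = solve-∀

      in-A : A u v ≡ true → Sig (Γ n A) x ≡ q u - r u v - s u v + 1ℤ
      in-A Auv = begin
          Sig (Γ n A) x                                   ≡⟨ Sig-at Auv ⟩
          Yof 1ℤ - (ΣR + ΣS - ΣD)                         ≡⟨ identity (α u v) (β u v) (α₂ v) (β₂ v) ΣD ΣR ΣS ⟩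
          D v + ΣD - ΣR - ΣS + 1ℤ                         ≡⟨ cong (_+ 1ℤ) qrs≡ ⟨
          q u - r u v - s u v + 1ℤ                        ∎
        where
        open ≡-Reasoning
        identity : ∀ a b a₂ b₂ ΣD ΣR ΣS →
                   a * b + 1ℤ * (a + b) + 1ℤ - (a + b) - a₂ - b₂ - (ΣR + ΣS - ΣD)
                   ≡ a * b - a₂ - b₂ + ΣD - ΣR - ΣS + 1ℤ
        identity = solve-∀

    module DistinctColumns (v w : Fin n) (N-v : xN x isIdx v) (S-w : xS x isIdx w) (v≢w : v ≢ w) where

      F G : ℤ
      F = α u v + U v - β u v
      G = β u w + U w - α u w

      Sig≡F*G : Sig (Γ n A) x ≡ F * G
      Sig≡F*G = begin
          Sig (Γ n A) x                                ≡⟨ Sig≡∏τ ⟩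
          cₛₜ (∏⊗ τ)                                   ≡⟨ cong cₛₜ (∏⊗-extract τ v) ⟩
          cₛₜ (τ v ⊗ ∏⊗ T₁)                           ≡⟨ cong (λ P → cₛₜ (τ v ⊗ P)) (∏⊗-extract T₁ w) ⟩
          cₛₜ (τ v ⊗ (T₁ w ⊗ ∏⊗ T₂))                  ≡⟨ cong₂ (λ t P → cₛₜ (t ⊗ P)) column-v (cong₂ _⊗_ column-w others) ⟩
          cₛₜ (⟨ 0ℤ , 0ℤ , F , 0ℤ ⟩ ⊗ (⟨ 0ℤ , G , 0ℤ , 0ℤ ⟩ ⊗ ⟨ 1ℤ , 0ℤ , 0ℤ , Σ ⟩))
                                                       ≡⟨ cₛₜ-pure-t F (⟨ 0ℤ , G , 0ℤ , 0ℤ ⟩ ⊗ ⟨ 1ℤ , 0ℤ , 0ℤ , Σ ⟩) ⟩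
          F * (0ℤ * 0ℤ + G * 1ℤ)                       ≡⟨ cong (F *_) (trans (ℤP.+-identityˡ (G * 1ℤ)) (ℤP.*-identityʳ G)) ⟩
          F * G                                        ∎
        where
        open ≡-Reasoning
        T₁ T₂ : Fin n → ℤst
        T₁ = erase 𝟙 τ v
        T₂ = erase 𝟙 T₁ w
        Σ = ∑ (erase 0ℤ (erase 0ℤ X v) w)
        column-v : τ v ≡ ⟨ 0ℤ , 0ℤ , F , 0ℤ ⟩
        column-v rewrite N-v v | S-w v | dec-true (v Fin.≟ v) refl | dec-false (v Fin.≟ w) v≢w = refl
        column-w : T₁ w ≡ ⟨ 0ℤ , G , 0ℤ , 0ℤ ⟩
        column-w rewrite dec-false (w Fin.≟ v) (v≢w ∘ sym) | N-v w | S-w w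
                       | dec-false (w Fin.≟ v) (v≢w ∘ sym) | dec-true (w Fin.≟ w) refl = refl
        others : ∏⊗ T₂ ≡ ⟨ 1ℤ , 0ℤ , 0ℤ , Σ ⟩
        others = trans (∏⊗-cong diag) (∏⊗-diagonal (erase 0ℤ (erase 0ℤ X v) w))
          where
          diag : ∀ j → T₂ j ≡ ⟨ 1ℤ , 0ℤ , 0ℤ , erase 0ℤ (erase 0ℤ X v) w j ⟩
          diag j with j Fin.≟ w
          ... | yes _ = refl
          ... | no j≢w with j Fin.≟ v
          ...   | yes _  = refl
          ...   | no j≢v = diagonal j (trans (N-v j) (dec-false (j Fin.≟ v) j≢v)) (trans (S-w j) (dec-false (j Fin.≟ w) j≢w))

      Sig-at : ∀ {b b'} → A u v ≡ b → A u w ≡ b' →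
               Sig (Γ n A) x ≡ (α u v + when b 1ℤ - β u v) * (β u w + when b' 1ℤ - α u w)
      Sig-at refl refl = Sig≡F*G

      case-ff : A u v ≡ false → A u w ≡ false → Sig (Γ n A) x ≡ p u v w
      case-ff Auv Auw = trans (Sig-at Auv Auw) (identity (α u v) (β u v) (α u w) (β u w))
        where
        identity : ∀ a b a' b' → (a + 0ℤ - b) * (b' + 0ℤ - a') ≡ (a - b) * (b' - a')
        identity = solve-∀

      case-ft : A u v ≡ false → A u w ≡ true → Sig (Γ n A) x ≡ p u v w + α u v - β u v
      case-ft Auv Auw = trans (Sig-at Auv Auw) (identity (α u v) (β u v) (α u w) (β u w))
        where
        identity : ∀ a b a' b' → (a + 0ℤ - b) * (b' + 1ℤ - a') ≡ (a - b) * (b' - a') + a - b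
        identity = solve-∀

      case-tf : A u v ≡ true → A u w ≡ false → Sig (Γ n A) x ≡ p u v w + β u w - α u w
      case-tf Auv Auw = trans (Sig-at Auv Auw) (identity (α u v) (β u v) (α u w) (β u w))
        where
        identity : ∀ a b a' b' → (a + 1ℤ - b) * (b' + 0ℤ - a') ≡ (a - b) * (b' - a') + b' - a'
        identity = solve-∀

      case-tt : A u v ≡ true → A u w ≡ true → Sig (Γ n A) x ≡ p u v w + β u w - α u w + α u v - β u v + 1ℤ
      case-tt Auv Auw = trans (Sig-at Auv Auw) (identity (α u v) (β u v) (α u w) (β u w))
        where
        identity : ∀ a b a' b' → (a + 1ℤ - b) * (b' + 1ℤ - a') ≡ (a - b) * (b' - a') + b' - a' + a - b + 1ℤ
        identity = solve-∀

  one-hot : ∀ (s : Fin n → Bool) → hwF s ≡ 1 → ∃ λ v → s isIdx v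
  one-hot s hw≡1 = count≡1 s (trans (sym (hwF≡count s)) hw≡1)

  part-zero : φone x → (¬ (xW x ≐ xE x) ⊎ hwF (xS x) ≢ 1) → Sig (Γ n A) x ≡ 0ℤ
  part-zero (N≡1 , W≡1) W≉E⊎S≢1 with all? (λ i → xW x i Bool.≟ xE x i)
  ... | no W≉E  = let i , W≢E = ¬∀⟶∃¬ n _ (λ i → xW x i Bool.≟ xE x i) W≉E in Sig-zero-if-W≢E i W≢E
  ... | yes W≐E with W≉E⊎S≢1
  ...   | inj₁ W≉E = ⊥-elim (W≉E W≐E)
  ...   | inj₂ S≢1 = SignalRow.NorthAt.Sig-zero-if-south-not-one-hot u W-u W≐E v N-v S≢1
    where
    u = proj₁ (one-hot (xW x) W≡1)
    W-u = proj₂ (one-hot (xW x) W≡1)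
    v = proj₁ (one-hot (xN x) N≡1)
    N-v = proj₂ (one-hot (xN x) N≡1)

  part-same-column : φprop x → (u v : Fin n) → xW x isIdx u → xN x isIdx v →
                     (A u v ≡ false → Sig (Γ n A) x ≡ q u - r u v - s u v - α u v - β u v)
                     × (A u v ≡ true → Sig (Γ n A) x ≡ q u - r u v - s u v + 1ℤ)
  part-same-column (N≐S , W≐E) u v W-u N-v = off-A , in-A
    where open SignalRow.SameColumn u W-u W≐E v N-v (λ i → trans (sym (N≐S i)) (N-v i))

  part-distinct-columns : xW x ≐ xE x → ¬ (xN x ≐ xS x) → (u v w : Fin n) →
                          xW x isIdx u → xN x isIdx v → xS x isIdx w →
                          (A u v ≡ false → A u w ≡ false → Sig (Γ n A) x ≡ p u v w)
                          × (A u v ≡ false → A u w ≡ true → Sig (Γ n A) x ≡ p u v w + α u v - β u v)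
                          × (A u v ≡ true → A u w ≡ false → Sig (Γ n A) x ≡ p u v w + β u w - α u w)
                          × (A u v ≡ true → A u w ≡ true →
                             Sig (Γ n A) x ≡ p u v w + β u w - α u w + α u v - β u v + 1ℤ)
  part-distinct-columns W≐E N≉S u v w W-u N-v S-w = case-ff , case-ft , case-tf , case-tt
    where
    v≢w : v ≢ w
    v≢w refl = N≉S λ i → trans (N-v i) (sym (S-w i))
    open SignalRow.DistinctColumns u W-u W≐E v w N-v S-w v≢w

lemma33 : (n : ℕ) (A : Fin n → Fin n → Bool) (x : GDang n → Bool) → φone x →
  let open Quantities A in
  ((¬ (xW x ≐ xE x) ⊎ hwF (xS x) ≢ 1) → Sig (Γ n A) x ≡ 0ℤ)
  × (φprop x → (u v : Fin n) → xW x isIdx u → xN x isIdx v →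
      (A u v ≡ false → Sig (Γ n A) x ≡ q u - r u v - s u v - α u v - β u v)
      × (A u v ≡ true → Sig (Γ n A) x ≡ q u - r u v - s u v + 1ℤ))
  × (xW x ≐ xE x → hwF (xS x) ≡ 1 → ¬ (xN x ≐ xS x) →
      (u v w : Fin n) → xW x isIdx u → xN x isIdx v → xS x isIdx w →
      (A u v ≡ false → A u w ≡ false → Sig (Γ n A) x ≡ p u v w)
      × (A u v ≡ false → A u w ≡ true → Sig (Γ n A) x ≡ p u v w + α u v - β u v)
      × (A u v ≡ true → A u w ≡ false → Sig (Γ n A) x ≡ p u v w + β u w - α u w)
      × (A u v ≡ true → A u w ≡ true →
          Sig (Γ n A) x ≡ p u v w + β u w - α u w + α u v - β u v + 1ℤ))
lemma33 zero    A x (() , _)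
lemma33 (suc m) A x φ = part-zero φ , part-same-column , λ W≐E _ → part-distinct-columns W≐E
  where open Final m A x
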